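{- For every integer $k\ge 3$ there exists a $2$-edge-connected plane graph $G$ with exactly $4k$ vertices such that $\chi_{fp}(G)=12$.
   Context: All graphs are finite, planar, with a fixed plane embedding. A vertex-coloring of $G$ is a map $V(G)\to\mathbb{N}$. A facial-parity vertex-coloring of a plane graph $G$ is a facially-proper vertex-coloring (any two vertices appearing consecutively on the boundary of a face, i.e. adjacent vertices, receive distinct colors) such that for every face $\alpha$ and every color $c$, the number of vertices incident with $\alpha$ having color $c$ is either zero or odd. $\chi_{fp}(G)$ denotes the minimum number of colors in a facial-parity vertex-coloring of $G$. -}

module Defs where

open import Data.Nat using (ℕ; zero; suc; _+_; _*_; _≤_)
open import Data.Nat.Properties using () renaming (_≟_ to _≟ℕ_)
open import Data.Fin using (Fin)
open import Data.Fin.Properties using (any?) renaming (_≟_ to _≟F_)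
open import Data.List using (List; length; filter; map; deduplicate; allFin)
open import Data.Product using (Σ; ∃; ∃-syntax; _×_; _,_)
open import Data.Sum using (_⊎_)
open import Relation.Nullary using (¬_; Dec)
open import Relation.Nullary.Decidable using (_×-dec_)
open import Relation.Binary.PropositionalEquality using (_≡_; _≢_)
open import Relation.Binary.Construct.Closure.ReflexiveTransitive using (Star)

Odd : ℕ → Set
Odd c = ∃[ j ] c ≡ suc (2 * j)

iter : {A : Set} → (A → A) → ℕ → A → A
iter g zero    x = x
iter g (suc k) x = g (iter g k x)

-- A combinatorial map (rotation system) encoding a graph with a
-- 2-cell embedding: darts Fin (2 * m) (two per edge, m edges),
-- α = fixed-point-free involution pairing the two darts of an edge,
-- σ = rotation (cyclic order of darts around each vertex),
-- vertices = σ-orbits (labelled by vert : darts → Fin n),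
-- faces = orbits of φ = σ ∘ α (labelled by face : darts → Fin f).
record Map : Set where
  field
    n m f : ℕ
    α σ σ⁻ : Fin (2 * m) → Fin (2 * m)
    vert : Fin (2 * m) → Fin n
    face : Fin (2 * m) → Fin f
    α-invol  : ∀ x → α (α x) ≡ x
    α-nofix  : ∀ x → α x ≢ x
    σ-inv₁   : ∀ x → σ (σ⁻ x) ≡ x
    σ-inv₂   : ∀ x → σ⁻ (σ x) ≡ x
    vert-σ   : ∀ x → vert (σ x) ≡ vert x
    vert-orb : ∀ x y → vert x ≡ vert y → ∃[ k ] iter σ k x ≡ y
    face-φ   : ∀ x → face (σ (α x)) ≡ face x
    face-orb : ∀ x y → face x ≡ face y → ∃[ k ] iter (λ z → σ (α z)) k x ≡ y
    face-sur : ∀ i → ∃[ x ] face x ≡ i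

  Dart : Set
  Dart = Fin (2 * m)

  Adj : Fin n → Fin n → Set
  Adj u v = ∃[ x ] (vert x ≡ u × vert (α x) ≡ v)

  AdjWithout : Dart → Fin n → Fin n → Set
  AdjWithout e u v = ∃[ x ] (x ≢ e × x ≢ α e × vert x ≡ u × vert (α x) ≡ v)

  Incident : Fin n → Fin f → Set
  Incident v i = ∃[ x ] (face x ≡ i × vert x ≡ v)

  incident? : ∀ v i → Dec (Incident v i)
  incident? v i = any? (λ x → (face x ≟F i) ×-dec (vert x ≟F v))

open Map public

Connected : Map → Set
Connected G = ∀ u v → Star (Adj G) u v

-- A plane graph: a connected graph with a genus-0 embedding,
-- i.e. Euler's formula V - E + F = 2 holds for the map.
IsPlane : Map → Set
IsPlane G = Connected G × (n G + f G ≡ m G + 2)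

Simple : Map → Set
Simple G = (∀ x → vert G x ≢ vert G (α G x))
         × (∀ x y → vert G x ≡ vert G y → vert G (α G x) ≡ vert G (α G y) → x ≡ y)

TwoEdgeConnected : Map → Set
TwoEdgeConnected G = Connected G × (∀ e u v → Star (AdjWithout G e) u v)

countColour : (G : Map) → (Fin (n G) → ℕ) → Fin (f G) → ℕ → ℕ
countColour G col i c =
  length (filter (λ v → incident? G v i ×-dec (col v ≟ℕ c)) (allFin (n G)))

IsFPColouring : (G : Map) → (Fin (n G) → ℕ) → Set
IsFPColouring G col =
  (∀ x → col (vert G x) ≢ col (vert G (α G x)))
  × (∀ i c → countColour G col i c ≡ 0 ⊎ Odd (countColour G col i c))

numColours : (G : Map) → (Fin (n G) → ℕ) → ℕ
numColours G col = length (deduplicate _≟ℕ_ (map col (allFin (n G))))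

χfp≡ : Map → ℕ → Set
χfp≡ G k = (∃[ col ] (IsFPColouring G col × numColours G col ≡ k))
         × (∀ col → IsFPColouring G col → k ≤ numColours G col)

module Submission where

-- The graph is a triangular prism whose three lateral edges are subdivided into paths P₀, P₁, P₂
-- on 4, 4 and 4(k − 2) vertices; its faces are the two triangles and the lateral faces P₀ ∪ P₁,
-- P₁ ∪ P₂ and P₀ ∪ P₂.  Let x, y, z count a colour on P₀, P₁, P₂ in a facial-parity colouring.
-- Each of x + y, y + z and x + z is zero or odd while their sum is even, so a colour used on P₂
-- does not occur on P₀ ∪ P₁; and a colour missing from P₂ occurs at most once on P₀ ∪ P₁, as a
-- proper path on 4 vertices uses a colour at most twice.  Hence every colour on P₂ occurs an odd
-- number of times there, which forces four colours on P₂: two colours would alternate and each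
-- occur an even number of times, and three odd counts cannot add up to the even length of P₂.
-- With the 8 distinct colours of P₀ ∪ P₁ this gives 12.  Conversely, colouring P₀ with 0–3, P₁
-- with 4–7 and P₂ with 10, 11, 8, 9, 8, 9, … is a facial-parity colouring with 12 colours.

open import Defs
open import Data.Bool using (Bool; true; false; T; not; _∧_; _∨_)
open import Data.Empty using (⊥-elim)
open import Data.Fin using (Fin; zero; suc; toℕ; inject₁; fromℕ; _↑ˡ_; _↑ʳ_)
open import Data.Fin.Patterns using (0F; 1F; 2F)
open import Data.Fin.Properties as Finₚ
  using (toℕ-inject₁; toℕ-fromℕ; toℕ-injective; toℕ<n; any?; +↔⊎; *↔×; 2↔Bool) renaming (_≟_ to _≟ᶠ_)
open import Data.Fin.Relation.Unary.Top using (view; ‵fromℕ; ‵inject₁; view-inject₁; view-fromℕ)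
open import Data.List using (List; []; _∷_; length; filter; tabulate; _++_; map; deduplicate; allFin)
open import Data.Maybe as Maybe using (Maybe; just; nothing)
open import Data.Maybe.Properties using (just-injective)
open import Data.List.Properties
  using ( filter-++; filter-none; filter-some; filter-accept; filter-reject
        ; length-++; length-map; length-removeAt′; length-upTo)
open import Data.List.Membership.Propositional.Properties
  using (∈-map⁺; ∈-map⁻; ∈-allFin; ∈-upTo⁺; ∈-deduplicate⁺; ∈-deduplicate⁻; ∈-++⁻; ∈-tabulate⁻)
open import Data.List.Membership.Propositional using (_∈_; _─_)
open import Data.List.Relation.Binary.Subset.Propositional using (_⊆_)
open import Data.List.Relation.Unary.All as All using (All; []; _∷_)
open import Data.List.Relation.Unary.AllPairs using ([]; _∷_)
open import Data.List.Relation.Unary.Any as Any using (here; there; index)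
open import Data.List.Relation.Unary.Unique.Propositional using (Unique)
open import Data.Nat using (ℕ; zero; suc; _+_; _*_; _≤_; _<_; z≤n; s≤s; s≤s⁻¹; _≡ᵇ_; parity)
open import Data.Nat.Properties
open import Data.List.Relation.Unary.Unique.DecPropositional.Properties _≟_ using (deduplicate-!)
open import Data.Nat.Tactic.RingSolver using (solve-∀)
open import Data.Parity.Base as ℙ using (0ℙ; 1ℙ)
open import Data.Parity.Properties using (+-homo-+; *-homo-*)
open import Data.Product using (Σ; ∃-syntax; _×_; _,_; proj₁; proj₂)
open import Data.Sum as Sum using (_⊎_; inj₁; inj₂; [_,_]′)
open import Function using (id; _∘_; _⇔_; _↔_; Inverse; Injection; mk⇔; mk↔ₛ′)
open import Function.Properties.Equivalence using () renaming (trans to ⇔-trans)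
open import Function.Properties.Inverse using (↔-refl; ↔-sym; ↔-trans; ↔⇒↣)
open import Data.Sum.Function.Propositional using (_⊎-↔_)
open import Data.Product.Function.NonDependent.Propositional using (_×-↔_)
open import Relation.Binary.Construct.Closure.ReflexiveTransitive
  using (Star; ε; _◅_; _◅◅_; gmap; foldl; reverse; _>>=_)
open import Relation.Binary.PropositionalEquality
open import Relation.Nullary using (¬_; yes; no; does; contradiction)
open import Relation.Nullary.Decidable using (_⊎-dec_; _×-dec_; ¬?; decidable-stable; does-⇔; T?)
open import Relation.Unary using (Decidable)

-- Counting

⟦_⟧ : Bool → ℕ
⟦ false ⟧ = 0
⟦ true  ⟧ = 1

⟦⟧-T : ∀ {b} → T b → ⟦ b ⟧ ≡ 1
⟦⟧-T {true} _ = refl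

⟦⟧-¬T : ∀ {b} → ¬ T b → ⟦ b ⟧ ≡ 0
⟦⟧-¬T {false} _  = refl
⟦⟧-¬T {true}  ¬t = ⊥-elim (¬t _)

⟦≡ᵇ⟧-refl : ∀ n → ⟦ n ≡ᵇ n ⟧ ≡ 1
⟦≡ᵇ⟧-refl n = ⟦⟧-T (≡⇒≡ᵇ n n refl)

⟦≡ᵇ⟧-≢ : ∀ {m n} → m ≢ n → ⟦ m ≡ᵇ n ⟧ ≡ 0
⟦≡ᵇ⟧-≢ {m} {n} m≢n = ⟦⟧-¬T (m≢n ∘ ≡ᵇ⇒≡ m n)

count : ∀ {n} → (Fin n → Bool) → ℕ
count {zero}  p = 0
count {suc n} p = ⟦ p zero ⟧ + count (p ∘ suc)

count-cong : ∀ {n} {p q : Fin n → Bool} → (∀ i → p i ≡ q i) → count p ≡ count q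
count-cong {zero}  _  = refl
count-cong {suc n} eq = cong₂ _+_ (cong ⟦_⟧ (eq zero)) (count-cong (eq ∘ suc))

count-↑ : ∀ m {n} (p : Fin (m + n) → Bool) →
          count p ≡ count (p ∘ (_↑ˡ n)) + count (p ∘ (m ↑ʳ_))
count-↑ zero    p = refl
count-↑ (suc m) p =
  trans (cong (⟦ p zero ⟧ +_) (count-↑ m (p ∘ suc))) (sym (+-assoc ⟦ p zero ⟧ _ _))

count-none : ∀ {n} (p : Fin n → Bool) → (∀ i → ¬ T (p i)) → count p ≡ 0
count-none {zero}  p none = refl
count-none {suc n} p none = cong₂ _+_ (⟦⟧-¬T (none zero)) (count-none (p ∘ suc) (none ∘ suc))

count-positive : ∀ {n} (p : Fin n → Bool) i → T (p i) → 0 < count p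
count-positive p zero    t = ≤-trans (≤-reflexive (sym (⟦⟧-T t))) (m≤m+n _ _)
count-positive p (suc i) t = ≤-trans (count-positive (p ∘ suc) i t) (m≤n+m _ _)

count≤1 : ∀ {n} (p : Fin n → Bool) → (∀ i j → T (p i) → T (p j) → i ≡ j) → count p ≤ 1
count≤1 {zero}  p _   = z≤n
count≤1 {suc n} p inj with p zero in eq
... | true  = ≤-reflexive (cong suc (count-none (p ∘ suc) λ i t →
                Finₚ.0≢1+n (inj zero (suc i) (subst T (sym eq) _) t)))
... | false = count≤1 (p ∘ suc) λ i j s t → Finₚ.suc-injective (inj (suc i) (suc j) s t)

count-false : ∀ {n} → count {n} (λ _ → false) ≡ 0
count-false {n} = count-none {n} (λ _ → false) (λ _ ())

count-first : ∀ {n} (p : Fin (suc n) → Bool) → count (λ i → (toℕ i ≡ᵇ 0) ∧ p i) ≡ ⟦ p zero ⟧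
count-first {n} p = trans (cong (⟦ p zero ⟧ +_) (count-false {n})) (+-identityʳ _)

count-last : ∀ n (p : Fin (suc n) → Bool) → count (λ i → (toℕ i ≡ᵇ n) ∧ p i) ≡ ⟦ p (fromℕ n) ⟧
count-last zero    p = +-identityʳ _
count-last (suc n) p = count-last n (p ∘ suc)

count-partition₃ : ∀ {n} (p q r : Fin n → Bool) → (∀ i → ⟦ p i ⟧ + ⟦ q i ⟧ + ⟦ r i ⟧ ≡ 1) →
                   count p + count q + count r ≡ n
count-partition₃ {zero}  p q r one = refl
count-partition₃ {suc n} p q r one = begin
  (⟦ p zero ⟧ + count (p ∘ suc)) + (⟦ q zero ⟧ + count (q ∘ suc)) + (⟦ r zero ⟧ + count (r ∘ suc))
    ≡⟨ regroup ⟦ p zero ⟧ ⟦ q zero ⟧ ⟦ r zero ⟧ _ _ _ ⟩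
  (⟦ p zero ⟧ + ⟦ q zero ⟧ + ⟦ r zero ⟧) + (count (p ∘ suc) + count (q ∘ suc) + count (r ∘ suc))
    ≡⟨ cong₂ _+_ (one zero) (count-partition₃ (p ∘ suc) (q ∘ suc) (r ∘ suc) (one ∘ suc)) ⟩
  suc n ∎
  where
  open ≡-Reasoning
  regroup : ∀ a b c x y z → (a + x) + (b + y) + (c + z) ≡ (a + b + c) + (x + y + z)
  regroup = solve-∀

length-filter-tabulate : ∀ {A : Set} {P : A → Set} (P? : Decidable P) {n} (g : Fin n → A) →
                         length (filter P? (tabulate g)) ≡ count (does ∘ P? ∘ g)
length-filter-tabulate P? {zero}  g = refl
length-filter-tabulate P? {suc n} g with does (P? (g zero))
... | true  = cong suc (length-filter-tabulate P? (g ∘ suc))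
... | false = length-filter-tabulate P? (g ∘ suc)

-- Parity

ZeroOrOdd : ℕ → Set
ZeroOrOdd n = n ≡ 0 ⊎ Odd n

parity-odd : ∀ {n} → Odd n → parity n ≡ 1ℙ
parity-odd (j , refl) = trans (+-homo-+ 1 (2 * j)) (cong (1ℙ ℙ.+_) (*-homo-* 2 j))

parity-even : ∀ n → parity (n * 2) ≡ 0ℙ
parity-even n = trans (cong parity (*-comm n 2)) (*-homo-* 2 n)

odd≢even : ∀ {a} n → Odd a → a ≢ n * 2
odd≢even n odd refl with () ← trans (sym (parity-odd odd)) (parity-even n)

odd-sum₃≢even : ∀ {a b c} n → Odd a → Odd b → Odd c → a + b + c ≢ n * 2
odd-sum₃≢even {a} {b} {c} n oa ob oc a+b+c≡2n = contradiction 1ℙ≡0ℙ λ ()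
  where
  open ≡-Reasoning
  1ℙ≡0ℙ : 1ℙ ≡ 0ℙ
  1ℙ≡0ℙ = begin
    1ℙ ℙ.+ 1ℙ ℙ.+ 1ℙ                    ≡⟨ sym (cong₂ ℙ._+_ (cong₂ ℙ._+_ (parity-odd oa) (parity-odd ob))
                                                          (parity-odd oc)) ⟩
    parity a ℙ.+ parity b ℙ.+ parity c  ≡⟨ sym (trans (+-homo-+ (a + b) c)
                                                          (cong (ℙ._+ parity c) (+-homo-+ a b))) ⟩
    parity (a + b + c)                  ≡⟨ cong parity a+b+c≡2n ⟩
    parity (n * 2)                      ≡⟨ parity-even n ⟩
    0ℙ                                  ∎

zeroOrOdd-positive : ∀ {n} → ZeroOrOdd n → 0 < n → Odd n
zeroOrOdd-positive (inj₁ refl) ()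
zeroOrOdd-positive (inj₂ odd)  _ = odd

≤1⇒zeroOrOdd : ∀ {n} → n ≤ 1 → ZeroOrOdd n
≤1⇒zeroOrOdd z≤n       = inj₁ refl
≤1⇒zeroOrOdd (s≤s z≤n) = inj₂ (0 , refl)

zeroOrOdd-+ : ∀ {x y} → ZeroOrOdd x → ZeroOrOdd y → x ≡ 0 ⊎ y ≡ 0 → ZeroOrOdd (x + y)
zeroOrOdd-+     _  zy (inj₁ refl) = zy
zeroOrOdd-+ {x} zx _  (inj₂ refl) = subst ZeroOrOdd (sym (+-identityʳ x)) zx

zeroOrOdd≤2⇒≤1 : ∀ {x} → x ≤ 2 → ZeroOrOdd x → x ≤ 1
zeroOrOdd≤2⇒≤1 {0}                   _ _          = z≤n
zeroOrOdd≤2⇒≤1 {1}                   _ _          = ≤-refl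
zeroOrOdd≤2⇒≤1 {2}                   _ (inj₂ odd) = contradiction refl (odd≢even 1 odd)
zeroOrOdd≤2⇒≤1 {suc (suc (suc _))} (s≤s (s≤s ())) _

pairedCounts-vanish : ∀ {x y z} → ZeroOrOdd (x + y) → ZeroOrOdd (y + z) → ZeroOrOdd (x + z) →
                      0 < z → x + y ≡ 0
pairedCounts-vanish (inj₁ x+y≡0) _ _ _ = x+y≡0
pairedCounts-vanish {x} {y} {z} (inj₂ oxy) yz xz 0<z =
  contradiction (double x y z)
    (odd-sum₃≢even (x + y + z) oxy (zeroOrOdd-positive yz (≤-trans 0<z (m≤n+m z y)))
                                   (zeroOrOdd-positive xz (≤-trans 0<z (m≤n+m z x))))
  where
  double : ∀ x y z → x + y + (y + z) + (x + z) ≡ (x + y + z) * 2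
  double = solve-∀

pairedCounts≤1 : ∀ {x y} → x ≤ 2 → y ≤ 2 → ZeroOrOdd x → ZeroOrOdd y → ZeroOrOdd (x + y) → x + y ≤ 1
pairedCounts≤1 x≤2 y≤2 zx zy zxy with zeroOrOdd≤2⇒≤1 x≤2 zx | zeroOrOdd≤2⇒≤1 y≤2 zy
... | z≤n     | y≤1     = y≤1
... | s≤s z≤n | z≤n     = ≤-refl
... | s≤s z≤n | s≤s z≤n with inj₂ odd ← zxy = contradiction refl (odd≢even 1 odd)

-- Colourings of paths

ProperPath : ∀ {n} → (Fin (suc n) → ℕ) → Set
ProperPath {n} h = ∀ (e : Fin n) → h (inject₁ e) ≢ h (suc e)

occurrences : ∀ {n} → (Fin n → ℕ) → ℕ → ℕ
occurrences h c = count (λ i → h i ≡ᵇ c)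

occurrences-cong : ∀ {n} {g h : Fin n → ℕ} → (∀ i → g i ≡ h i) → ∀ c → occurrences g c ≡ occurrences h c
occurrences-cong g≗h c = count-cong λ i → cong (_≡ᵇ c) (g≗h i)

occurrences-disjoint : ∀ {m n} (g : Fin m → ℕ) (h : Fin n → ℕ) → (∀ i j → g i ≢ h j) →
                       ∀ c → occurrences g c ≡ 0 ⊎ occurrences h c ≡ 0
occurrences-disjoint g h disjoint c with any? (λ i → g i ≟ c)
... | yes (i , gi≡c) = inj₂ (count-none _ λ j t → disjoint i j (trans gi≡c (sym (≡ᵇ⇒≡ _ _ t))))
... | no  none       = inj₁ (count-none _ λ i t → none (i , ≡ᵇ⇒≡ _ _ t))

injective⇒zeroOrOdd : ∀ {n} (h : Fin n → ℕ) → (∀ {i k} → h i ≡ h k → i ≡ k) →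
                      ∀ c → ZeroOrOdd (occurrences h c)
injective⇒zeroOrOdd h injective c = ≤1⇒zeroOrOdd (count≤1 _ λ i k hi≡c hk≡c →
  injective (trans (≡ᵇ⇒≡ _ _ hi≡c) (sym (≡ᵇ⇒≡ _ _ hk≡c))))

count-pairs : ∀ {n} (p : Fin (2 + n) → Bool) →
              count p ≡ (⟦ p zero ⟧ + ⟦ p (suc zero) ⟧) + count (λ i → p (suc (suc i)))
count-pairs p = sym (+-assoc ⟦ p zero ⟧ _ _)

distinct-indicators≤1 : ∀ {x y} c → x ≢ y → ⟦ x ≡ᵇ c ⟧ + ⟦ y ≡ᵇ c ⟧ ≤ 1
distinct-indicators≤1 {x} {y} c x≢y with x ≟ c
... | yes refl = ≤-reflexive (cong₂ _+_ (⟦≡ᵇ⟧-refl x) (⟦≡ᵇ⟧-≢ (x≢y ∘ sym)))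
... | no  x≢c  = subst (_≤ 1) (cong (_+ ⟦ y ≡ᵇ c ⟧) (sym (⟦≡ᵇ⟧-≢ x≢c))) (⟦⟧≤1 (y ≡ᵇ c))
  where
  ⟦⟧≤1 : ∀ b → ⟦ b ⟧ ≤ 1
  ⟦⟧≤1 false = z≤n
  ⟦⟧≤1 true  = ≤-refl

distinct-indicators≡1 : ∀ {x y u w} → x ≢ y → x ≡ u ⊎ x ≡ w → y ≡ u ⊎ y ≡ w →
                        ⟦ x ≡ᵇ u ⟧ + ⟦ y ≡ᵇ u ⟧ ≡ 1
distinct-indicators≡1 {x}     x≢y (inj₁ refl) _           = cong₂ _+_ (⟦≡ᵇ⟧-refl x) (⟦≡ᵇ⟧-≢ (x≢y ∘ sym))
distinct-indicators≡1 {y = y} x≢y (inj₂ refl) (inj₁ refl) = cong₂ _+_ (⟦≡ᵇ⟧-≢ x≢y) (⟦≡ᵇ⟧-refl y)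
distinct-indicators≡1         x≢y (inj₂ refl) (inj₂ refl) = contradiction refl x≢y

occurrences-evenPath≤ : ∀ m (h : Fin (suc m * 2) → ℕ) → ProperPath h → ∀ c → occurrences h c ≤ suc m
occurrences-evenPath≤ m h proper c =
  subst (_≤ suc m) (sym (count-pairs (λ i → h i ≡ᵇ c)))
        (+-mono-≤ (distinct-indicators≤1 c (proper zero)) (rest m h proper))
  where
  rest : ∀ m (h : Fin (suc m * 2) → ℕ) → ProperPath h → occurrences (λ i → h (suc (suc i))) c ≤ m
  rest zero    _ _      = z≤n
  rest (suc m) h proper = occurrences-evenPath≤ m (λ i → h (suc (suc i))) (λ e → proper (suc (suc e))) c

occurrences-twoColouredPath : ∀ m (h : Fin (suc m * 2) → ℕ) → ProperPath h → ∀ {u w} →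
                              (∀ i → h i ≡ u ⊎ h i ≡ w) → occurrences h u ≡ suc m
occurrences-twoColouredPath m h proper {u} {w} two =
  trans (count-pairs (λ i → h i ≡ᵇ u))
        (cong₂ _+_ (distinct-indicators≡1 (proper zero) (two zero) (two (suc zero))) (rest m h proper two))
  where
  rest : ∀ m (h : Fin (suc m * 2) → ℕ) → ProperPath h → (∀ i → h i ≡ u ⊎ h i ≡ w) →
         occurrences (λ i → h (suc (suc i))) u ≡ m
  rest zero    _ _      _   = refl
  rest (suc m) h proper two =
    occurrences-twoColouredPath m (λ i → h (suc (suc i))) (λ e → proper (suc (suc e))) (λ i → two (suc (suc i)))

occurrences-threeColoured : ∀ {n} (h : Fin n → ℕ) {u v w} → u ≢ v → u ≢ w → v ≢ w →
                            (∀ i → h i ≡ u ⊎ h i ≡ v ⊎ h i ≡ w) →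
                            occurrences h u + occurrences h v + occurrences h w ≡ n
occurrences-threeColoured h {u} {v} {w} u≢v u≢w v≢w three = count-partition₃ _ _ _ (one ∘ three)
  where
  one : ∀ {x} → x ≡ u ⊎ x ≡ v ⊎ x ≡ w → ⟦ x ≡ᵇ u ⟧ + ⟦ x ≡ᵇ v ⟧ + ⟦ x ≡ᵇ w ⟧ ≡ 1
  one (inj₁ refl)        = cong₂ _+_ (cong₂ _+_ (⟦≡ᵇ⟧-refl u) (⟦≡ᵇ⟧-≢ u≢v)) (⟦≡ᵇ⟧-≢ u≢w)
  one (inj₂ (inj₁ refl)) = cong₂ _+_ (cong₂ _+_ (⟦≡ᵇ⟧-≢ (u≢v ∘ sym)) (⟦≡ᵇ⟧-refl v)) (⟦≡ᵇ⟧-≢ v≢w)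
  one (inj₂ (inj₂ refl)) = cong₂ _+_ (cong₂ _+_ (⟦≡ᵇ⟧-≢ (u≢w ∘ sym)) (⟦≡ᵇ⟧-≢ (v≢w ∘ sym))) (⟦≡ᵇ⟧-refl w)

oddPath-fourColours : ∀ m (h : Fin (suc m * 2 * 2) → ℕ) → ProperPath h → (∀ i → Odd (occurrences h (h i))) →
              ∃[ i₁ ] ∃[ i₂ ] ∃[ i₃ ] ∃[ i₄ ] Unique (h i₁ ∷ h i₂ ∷ h i₃ ∷ h i₄ ∷ [])
oddPath-fourColours m h proper odd with any? (λ i → ¬? (h i ≟ h zero ⊎-dec h i ≟ h (suc zero)))
... | no none = contradiction
  (occurrences-twoColouredPath (suc (m * 2)) h proper
     (λ i → decidable-stable (h i ≟ h zero ⊎-dec h i ≟ h (suc zero)) (λ ∉ → none (i , ∉))))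
  (odd≢even (suc m) (odd zero))
... | yes (r , r∉) with any? (λ i → ¬? (h i ≟ h zero ⊎-dec h i ≟ h (suc zero) ⊎-dec h i ≟ h r))
...   | no none = contradiction
  (occurrences-threeColoured h (proper zero) (r∉ ∘ inj₁ ∘ sym) (r∉ ∘ inj₂ ∘ sym)
     (λ i → decidable-stable (h i ≟ h zero ⊎-dec h i ≟ h (suc zero) ⊎-dec h i ≟ h r) (λ ∉ → none (i , ∉))))
  (odd-sum₃≢even (suc m * 2) (odd zero) (odd (suc zero)) (odd r))
...   | yes (s , s∉) = zero , suc zero , r , s ,
  (proper zero ∷ (r∉ ∘ inj₁ ∘ sym) ∷ (s∉ ∘ inj₁ ∘ sym) ∷ []) ∷
  ((r∉ ∘ inj₂ ∘ sym) ∷ (s∉ ∘ inj₂ ∘ inj₁ ∘ sym) ∷ []) ∷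
  ((s∉ ∘ inj₂ ∘ inj₂ ∘ sym) ∷ []) ∷ [] ∷ []

-- Multiplicities in lists

multiplicity : ℕ → List ℕ → ℕ
multiplicity c xs = length (filter (_≟ c) xs)

multiplicity-++ : ∀ c xs ys → multiplicity c (xs ++ ys) ≡ multiplicity c xs + multiplicity c ys
multiplicity-++ c xs ys = trans (cong length (filter-++ (_≟ c) xs ys)) (length-++ (filter (_≟ c) xs))

multiplicity-tabulate : ∀ c {n} (h : Fin n → ℕ) → multiplicity c (tabulate h) ≡ occurrences h c
multiplicity-tabulate c = length-filter-tabulate (_≟ c)

multiplicity-none : ∀ {c xs} → All (_≢ c) xs → multiplicity c xs ≡ 0
multiplicity-none {c} none = cong length (filter-none (_≟ c) none)

multiplicity-accept : ∀ {c x} xs → x ≡ c → multiplicity c (x ∷ xs) ≡ suc (multiplicity c xs)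
multiplicity-accept {c} xs x≡c = cong length (filter-accept (_≟ c) x≡c)

multiplicity-reject : ∀ {c x} xs → x ≢ c → multiplicity c (x ∷ xs) ≡ multiplicity c xs
multiplicity-reject {c} xs x≢c = cong length (filter-reject (_≟ c) x≢c)

Unique⇒multiplicity≤1 : ∀ {xs} → Unique xs → ∀ c → multiplicity c xs ≤ 1
Unique⇒multiplicity≤1 {[]}     _          c = z≤n
Unique⇒multiplicity≤1 {x ∷ xs} (x∉ ∷ xs!) c with x ≟ c
... | yes refl = ≤-reflexive (trans (multiplicity-accept xs refl)
                                    (cong suc (multiplicity-none (All.map (_∘ sym) x∉))))
... | no  x≢c  = subst (_≤ 1) (sym (multiplicity-reject xs x≢c)) (Unique⇒multiplicity≤1 xs! c)

multiplicity≤1⇒Unique : ∀ xs → (∀ c → multiplicity c xs ≤ 1) → Unique xs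
multiplicity≤1⇒Unique []       _       = []
multiplicity≤1⇒Unique (x ∷ xs) atMost1 = x∉xs ∷ multiplicity≤1⇒Unique xs tail≤1
  where
  x∉xs : All (x ≢_) xs
  x∉xs = All.tabulate λ { y∈xs refl →
    ≤⇒≯ (s≤s⁻¹ (subst (_≤ 1) (multiplicity-accept xs refl) (atMost1 x)))
        (filter-some (_≟ x) (Any.map sym y∈xs)) }
  tail≤1 : ∀ c → multiplicity c xs ≤ 1
  tail≤1 c with x ≟ c
  ... | yes x≡c = ≤-trans (n≤1+n _) (subst (_≤ 1) (multiplicity-accept xs x≡c) (atMost1 c))
  ... | no  x≢c = subst (_≤ 1) (multiplicity-reject xs x≢c) (atMost1 c)

∈-─ : ∀ {A : Set} {x y : A} {ys} (x∈ys : x ∈ ys) → y ∈ ys → x ≢ y → y ∈ ys ─ x∈ys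
∈-─ (here refl) (here refl) x≢y = contradiction refl x≢y
∈-─ (here refl) (there y∈ys) _  = y∈ys
∈-─ (there _)   (here refl) _   = here refl
∈-─ (there x∈ys) (there y∈ys) x≢y = there (∈-─ x∈ys y∈ys x≢y)

Unique⇒length≤ : ∀ {A : Set} {xs ys : List A} → Unique xs → xs ⊆ ys → length xs ≤ length ys
Unique⇒length≤ {xs = []}     _           _   = z≤n
Unique⇒length≤ {xs = x ∷ xs} {ys} (x∉xs ∷ xs!) xs⊆ys =
  subst (suc (length xs) ≤_) (sym (length-removeAt′ ys (index x∈ys)))
    (s≤s (Unique⇒length≤ xs! λ y∈xs → ∈-─ x∈ys (xs⊆ys (there y∈xs)) (All.lookup x∉xs y∈xs)))
  where
  x∈ys = xs⊆ys (here refl)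

numColours≤ : ∀ (G : Map) (col : Fin (n G) → ℕ) {k} → (∀ x → col x < k) → numColours G col ≤ k
numColours≤ G col {k} bounded =
  subst (numColours G col ≤_) (length-upTo k) (Unique⇒length≤ (deduplicate-! _) (∈-upTo⁺ ∘ colour<k))
  where
  colour<k : ∀ {c} → c ∈ deduplicate _≟_ (map col (allFin (n G))) → c < k
  colour<k c∈ with x , _ , refl ← ∈-map⁻ col (∈-deduplicate⁻ _≟_ _ c∈) = bounded x

length≤numColours : ∀ (G : Map) (col : Fin (n G) → ℕ) {cs} → Unique cs →
                    (∀ {c} → c ∈ cs → ∃[ x ] col x ≡ c) → length cs ≤ numColours G col
length≤numColours G col cs! used = Unique⇒length≤ cs! λ c∈cs →
  let x , colx≡c = used c∈cs in subst (_∈ _) colx≡c (∈-deduplicate⁺ _≟_ (∈-map⁺ col (∈-allFin x)))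

-- Walks

Step : ∀ {A : Set} → (A → A) → A → A → Set
Step g x y = g x ≡ y

Star-iter : ∀ {A : Set} {g : A → A} {x y} → Star (Step g) x y → ∃[ k ] iter g k x ≡ y
Star-iter {g = g} = foldl (λ x y → ∃[ k ] iter g k x ≡ y) (λ { (k , refl) refl → suc k , refl }) (0 , refl)

iter-cong : ∀ {A : Set} {g h : A → A} → (∀ x → g x ≡ h x) → ∀ k x → iter g k x ≡ iter h k x
iter-cong         g≗h zero    x = refl
iter-cong {h = h} g≗h (suc k) x = trans (g≗h _) (cong h (iter-cong g≗h k x))

walkDown : ∀ {n} {T : Fin (suc n) → Fin (suc n) → Set} (i : Fin (suc n)) →
           (∀ (e : Fin n) → toℕ e < toℕ i → T (suc e) (inject₁ e)) → Star T i zero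
walkDown zero    _    = ε
walkDown {suc n} {T} (suc i) step =
  step i ≤-refl ◅ gmap inject₁ id
    (walkDown {T = λ a b → T (inject₁ a) (inject₁ b)} i
       λ e e<i → step (inject₁ e) (s≤s (≤-trans (≤-reflexive (toℕ-inject₁ e)) (<⇒≤ e<i))))

walkDownFromLast : ∀ {n} {T : Fin (suc n) → Fin (suc n) → Set} (j : Fin (suc n)) →
                   (∀ (e : Fin n) → toℕ j ≤ toℕ e → T (suc e) (inject₁ e)) → Star T (fromℕ n) j
walkDownFromLast {zero}  zero    _    = ε
walkDownFromLast {suc n} zero    step = walkDown (fromℕ (suc n)) (λ e _ → step e z≤n)
walkDownFromLast {suc n} {T} (suc j) step =
  gmap suc id (walkDownFromLast {T = λ a b → T (suc a) (suc b)} j λ e j≤e → step (suc e) (s≤s j≤e))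

-- Combinatorial maps

AdjWithout-sym : (G : Map) → ∀ {e u v} → AdjWithout G e u v → AdjWithout G e v u
AdjWithout-sym G {e} (x , x≢e , x≢αe , refl , refl) =
  α G x , (λ αx≡e → x≢αe (trans (sym (α-invol G x)) (cong (α G) αx≡e)))
        , (λ αx≡αe → x≢e (trans (sym (α-invol G x)) (trans (cong (α G) αx≡αe) (α-invol G e))))
        , refl , cong (vert G) (α-invol G x)

detours⇒twoEdgeConnected : (G : Map) → Connected G →
                           (∀ e → Star (AdjWithout G e) (vert G e) (vert G (α G e))) →
                           TwoEdgeConnected G
detours⇒twoEdgeConnected G connected detour = connected , λ e u v → connected u v >>= avoid e
  where
  avoid : ∀ e {u v} → Adj G u v → Star (AdjWithout G e) u v
  avoid e (x , refl , refl) with x ≟ᶠ e | x ≟ᶠ α G e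
  ... | yes refl | _        = detour x
  ... | no  _    | yes refl = subst (Star (AdjWithout G e) (vert G (α G e)))
                                    (cong (vert G) (sym (α-invol G e)))
                                    (reverse (AdjWithout-sym G) (detour e))
  ... | no x≢e   | no x≢αe  = (x , x≢e , x≢αe , refl , refl) ◅ ε

record CombinatorialMap (Dart Vertex Face : Set) : Set where
  field
    opposite rotate rotate⁻ : Dart → Dart
    vertexOf : Dart → Vertex
    faceOf   : Dart → Face
    opposite-involutive    : ∀ d → opposite (opposite d) ≡ d
    opposite-fixpointFree  : ∀ d → opposite d ≢ d
    rotate-rotate⁻         : ∀ d → rotate (rotate⁻ d) ≡ d
    rotate⁻-rotate         : ∀ d → rotate⁻ (rotate d) ≡ d
    vertexOf-rotate        : ∀ d → vertexOf (rotate d) ≡ vertexOf d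
    vertex-orbit           : ∀ d d′ → vertexOf d ≡ vertexOf d′ → Star (Step rotate) d d′
    faceOf-rotate-opposite : ∀ d → faceOf (rotate (opposite d)) ≡ faceOf d
    face-orbit             : ∀ d d′ → faceOf d ≡ faceOf d′ → Star (Step (rotate ∘ opposite)) d d′
    faceOf-surjective      : ∀ i → ∃[ d ] faceOf d ≡ i

  Adjacent : Vertex → Vertex → Set
  Adjacent u v = ∃[ d ] (vertexOf d ≡ u × vertexOf (opposite d) ≡ v)

  AdjacentAvoiding : Dart → Vertex → Vertex → Set
  AdjacentAvoiding e u v = ∃[ d ] (d ≢ e × d ≢ opposite e × vertexOf d ≡ u × vertexOf (opposite d) ≡ v)

  IncidentTo : Vertex → Face → Set
  IncidentTo v i = ∃[ d ] (faceOf d ≡ i × vertexOf d ≡ v)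

  AdjacentAvoiding-sym : ∀ {e u v} → AdjacentAvoiding e u v → AdjacentAvoiding e v u
  AdjacentAvoiding-sym {e} (d , d≢e , d≢αe , refl , refl) =
    opposite d , (λ αd≡e → d≢αe (trans (sym (opposite-involutive d)) (cong opposite αd≡e)))
               , (λ αd≡αe → d≢e (trans (sym (opposite-involutive d))
                                        (trans (cong opposite αd≡αe) (opposite-involutive e))))
               , refl , cong vertexOf (opposite-involutive d)

  AdjacentAvoiding-opposite : ∀ {e u v} → AdjacentAvoiding e u v → AdjacentAvoiding (opposite e) u v
  AdjacentAvoiding-opposite {e} (d , d≢e , d≢αe , d↦u , αd↦v) =
    d , d≢αe , (λ d≡ααe → d≢e (trans d≡ααe (opposite-involutive e))) , d↦u , αd↦v

  Adjacent-sym : ∀ {u v} → Adjacent u v → Adjacent v u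
  Adjacent-sym (d , refl , refl) = opposite d , refl , cong vertexOf (opposite-involutive d)

module Encoding {D V F : Set} (M : CombinatorialMap D V F) {m n f : ℕ}
                (darts : D ↔ Fin (2 * m)) (vertices : V ↔ Fin n) (faces : F ↔ Fin f) where

  open CombinatorialMap M
  private
    module Dᵉ = Inverse darts
    module Vᵉ = Inverse vertices
    module Fᵉ = Inverse faces

    to-injective : ∀ {A B : Set} (e : A ↔ B) {x y} → Inverse.to e x ≡ Inverse.to e y → x ≡ y
    to-injective e = Injection.injective (↔⇒↣ e)

    conj : (D → D) → Fin (2 * m) → Fin (2 * m)
    conj g = Dᵉ.to ∘ g ∘ Dᵉ.from

    conj-∘ : ∀ g h x → conj g (conj h x) ≡ conj (g ∘ h) x
    conj-∘ g h x = cong (Dᵉ.to ∘ g) (Dᵉ.strictlyInverseʳ (h (Dᵉ.from x)))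

    conj-id : ∀ {g} → (∀ d → g d ≡ d) → ∀ x → conj g x ≡ x
    conj-id g≗id x = trans (cong Dᵉ.to (g≗id (Dᵉ.from x))) (Dᵉ.strictlyInverseˡ x)

    conj-iter : ∀ g k x → iter (conj g) k x ≡ conj (iter g k) x
    conj-iter g zero    x = sym (Dᵉ.strictlyInverseˡ x)
    conj-iter g (suc k) x = trans (cong (conj g) (conj-iter g k x)) (conj-∘ g (iter g k) x)

    conj-orbit : ∀ g x y → Star (Step g) (Dᵉ.from x) (Dᵉ.from y) → ∃[ k ] iter (conj g) k x ≡ y
    conj-orbit g x y steps with k , gᵏx≡y ← Star-iter steps =
      k , trans (conj-iter g k x) (trans (cong Dᵉ.to gᵏx≡y) (Dᵉ.strictlyInverseˡ y))

  encoded : Map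
  encoded = record
    { n = n ; m = m ; f = f
    ; α = conj opposite ; σ = conj rotate ; σ⁻ = conj rotate⁻
    ; vert = Vᵉ.to ∘ vertexOf ∘ Dᵉ.from
    ; face = Fᵉ.to ∘ faceOf ∘ Dᵉ.from
    ; α-invol = λ x → trans (conj-∘ opposite opposite x) (conj-id opposite-involutive x)
    ; α-nofix = λ x αx≡x → opposite-fixpointFree (Dᵉ.from x)
                             (trans (sym (Dᵉ.strictlyInverseʳ _)) (cong Dᵉ.from αx≡x))
    ; σ-inv₁ = λ x → trans (conj-∘ rotate rotate⁻ x) (conj-id rotate-rotate⁻ x)
    ; σ-inv₂ = λ x → trans (conj-∘ rotate⁻ rotate x) (conj-id rotate⁻-rotate x)
    ; vert-σ = λ x → cong Vᵉ.to (trans (cong vertexOf (Dᵉ.strictlyInverseʳ _)) (vertexOf-rotate _))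
    ; vert-orb = λ x y eq → conj-orbit rotate x y (vertex-orbit _ _ (to-injective vertices eq))
    ; face-φ = λ x → trans (cong (Fᵉ.to ∘ faceOf ∘ Dᵉ.from) (conj-∘ rotate opposite x))
                           (cong Fᵉ.to (trans (cong faceOf (Dᵉ.strictlyInverseʳ _))
                                              (faceOf-rotate-opposite _)))
    ; face-orb = λ x y eq →
        let k , φᵏx≡y = conj-orbit (rotate ∘ opposite) x y (face-orbit _ _ (to-injective faces eq))
        in  k , trans (iter-cong (conj-∘ rotate opposite) k x) φᵏx≡y
    ; face-sur = λ i → let d , d↦i = faceOf-surjective (Fᵉ.from i) in
        Dᵉ.to d , trans (cong (Fᵉ.to ∘ faceOf) (Dᵉ.strictlyInverseʳ d))
                        (trans (cong Fᵉ.to d↦i) (Fᵉ.strictlyInverseˡ i))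
    }

  vert-to : ∀ d → vert encoded (Dᵉ.to d) ≡ Vᵉ.to (vertexOf d)
  vert-to d = cong (Vᵉ.to ∘ vertexOf) (Dᵉ.strictlyInverseʳ d)

  vert-α : ∀ x → vert encoded (α encoded x) ≡ Vᵉ.to (vertexOf (opposite (Dᵉ.from x)))
  vert-α x = vert-to (opposite (Dᵉ.from x))

  vert-α-to : ∀ d → vert encoded (α encoded (Dᵉ.to d)) ≡ Vᵉ.to (vertexOf (opposite d))
  vert-α-to d = trans (vert-α (Dᵉ.to d)) (cong (Vᵉ.to ∘ vertexOf ∘ opposite) (Dᵉ.strictlyInverseʳ d))

  connected : (∀ u v → Star Adjacent u v) → Connected encoded
  connected walk x y = subst₂ (Star (Adj encoded)) (Vᵉ.strictlyInverseˡ x) (Vᵉ.strictlyInverseˡ y)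
                         (gmap Vᵉ.to adjacent-to (walk (Vᵉ.from x) (Vᵉ.from y)))
    where
    adjacent-to : ∀ {u v} → Adjacent u v → Adj encoded (Vᵉ.to u) (Vᵉ.to v)
    adjacent-to (d , refl , refl) = Dᵉ.to d , vert-to d , vert-α-to d

  twoEdgeConnected : (∀ u v → Star Adjacent u v) →
                     (∀ e → Star (AdjacentAvoiding e) (vertexOf e) (vertexOf (opposite e))) →
                     TwoEdgeConnected encoded
  twoEdgeConnected walk detour = detours⇒twoEdgeConnected encoded (connected walk) λ x →
    subst (Star (AdjWithout encoded x) (vert encoded x)) (sym (vert-α x))
          (gmap Vᵉ.to avoiding-to (detour (Dᵉ.from x)))
    where
    avoiding-to : ∀ {x u v} → AdjacentAvoiding (Dᵉ.from x) u v → AdjWithout encoded x (Vᵉ.to u) (Vᵉ.to v)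
    avoiding-to (d , d≢e , d≢αe , refl , refl) =
      Dᵉ.to d , (λ eq → d≢e (trans (sym (Dᵉ.strictlyInverseʳ d)) (cong Dᵉ.from eq)))
              , (λ eq → d≢αe (to-injective darts eq)) , vert-to d , vert-α-to d

  simple : (∀ d → vertexOf d ≢ vertexOf (opposite d)) →
           (∀ d d′ → vertexOf d ≡ vertexOf d′ → vertexOf (opposite d) ≡ vertexOf (opposite d′) → d ≡ d′) →
           Simple encoded
  simple noLoop noMultiEdge =
    (λ x loop → noLoop (Dᵉ.from x) (to-injective vertices (trans loop (vert-α x)))) ,
    (λ x y tails heads → to-injective (↔-sym darts) (noMultiEdge _ _ (to-injective vertices tails)
       (to-injective vertices (trans (sym (vert-α x)) (trans heads (vert-α y))))))

  incident⇔ : ∀ x j → Incident encoded x j ⇔ IncidentTo (Vᵉ.from x) (Fᵉ.from j)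
  incident⇔ x j = mk⇔
    (λ { (y , refl , refl) → Dᵉ.from y , sym (Fᵉ.strictlyInverseʳ _) , sym (Vᵉ.strictlyInverseʳ _) })
    (λ { (d , d↦j , d↦x) → Dᵉ.to d , trans (cong (Fᵉ.to ∘ faceOf) (Dᵉ.strictlyInverseʳ d))
                                             (trans (cong Fᵉ.to d↦j) (Fᵉ.strictlyInverseˡ j))
                                   , trans (vert-to d) (trans (cong Vᵉ.to d↦x) (Vᵉ.strictlyInverseˡ x)) })

  countColour-encoded : (on : F → V → Bool) → (∀ v i → IncidentTo v i ⇔ T (on i v)) →
                        ∀ col j c → countColour encoded col j c ≡
                                    count (λ x → on (Fᵉ.from j) (Vᵉ.from x) ∧ (col x ≡ᵇ c))
  countColour-encoded on incident⇔on col j c =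
    trans (length-filter-tabulate (λ x → incident? encoded x j ×-dec col x ≟ c) id) (count-cong λ x →
      cong (_∧ (col x ≡ᵇ c))
           (does-⇔ (⇔-trans (incident⇔ x j) (incident⇔on _ _)) (incident? encoded x j) (T? _)))

-- The subdivided triangular prism

next prev : Fin 3 → Fin 3
next 0F = 1F
next 1F = 2F
next 2F = 0F
prev 0F = 2F
prev 1F = 0F
prev 2F = 1F

next-prev : ∀ s → next (prev s) ≡ s
next-prev 0F = refl
next-prev 1F = refl
next-prev 2F = refl

prev-next : ∀ s → prev (next s) ≡ s
prev-next 0F = refl
prev-next 1F = refl
prev-next 2F = refl

next≢id : ∀ s → next s ≢ s
next≢id 0F ()
next≢id 1F ()
next≢id 2F ()

inject₁≢suc : ∀ {n} (e : Fin n) → inject₁ e ≢ suc e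
inject₁≢suc e eq = 1+n≢n (sym (trans (sym (toℕ-inject₁ e)) (cong toℕ eq)))

_⊎-Fin_ : ∀ {A B : Set} {a b} → A ↔ Fin a → B ↔ Fin b → (A ⊎ B) ↔ Fin (a + b)
A↔a ⊎-Fin B↔b = ↔-trans (A↔a ⊎-↔ B↔b) (↔-sym +↔⊎)

module Prism (ℓ : Fin 3 → ℕ) where

  edges : Fin 3 → ℕ
  edges s = suc (ℓ s)

  data Vertex : Set where
    vx : (s : Fin 3) → Fin (suc (edges s)) → Vertex

  last : ∀ s → Fin (suc (edges s))
  last s = fromℕ (edges s)

  -- pathEdge s e joins vx s (inject₁ e) to vx s (suc e); bottomEdge s and topEdge s join the
  -- first and the last vertices of the paths s and next s.
  data Edge : Set where
    pathEdge : (s : Fin 3) → Fin (edges s) → Edge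
    bottomEdge topEdge : Fin 3 → Edge

  -- lateral s is bounded by the paths s and next s.
  data Face : Set where
    lateral : Fin 3 → Face
    bottom top : Face

  -- (false , e) is the half-edge of e at its first endpoint.
  HalfEdge : Set
  HalfEdge = Bool × Edge

  opposite : HalfEdge → HalfEdge
  opposite (b , e) = not b , e

  vertexOf : HalfEdge → Vertex
  vertexOf (false , pathEdge s e) = vx s (inject₁ e)
  vertexOf (true  , pathEdge s e) = vx s (suc e)
  vertexOf (false , bottomEdge s) = vx s zero
  vertexOf (true  , bottomEdge s) = vx (next s) zero
  vertexOf (false , topEdge s)    = vx s (last s)
  vertexOf (true  , topEdge s)    = vx (next s) (last (next s))

  rotate rotate⁻ : HalfEdge → HalfEdge
  rotate (false , pathEdge s zero)    = true , bottomEdge (prev s)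
  rotate (false , pathEdge s (suc e)) = true , pathEdge s (inject₁ e)
  rotate (true  , pathEdge s e) with view e
  ... | ‵fromℕ      = false , topEdge s
  ... | ‵inject₁ e′ = false , pathEdge s (suc e′)
  rotate (false , bottomEdge s) = false , pathEdge s zero
  rotate (true  , bottomEdge s) = false , bottomEdge (next s)
  rotate (false , topEdge s)    = true , topEdge (prev s)
  rotate (true  , topEdge s)    = true , pathEdge (next s) (fromℕ (ℓ (next s)))

  rotate⁻ (false , pathEdge s zero)    = false , bottomEdge s
  rotate⁻ (false , pathEdge s (suc e)) = true , pathEdge s (inject₁ e)
  rotate⁻ (true  , pathEdge s e) with view e
  ... | ‵fromℕ      = true , topEdge (prev s)
  ... | ‵inject₁ e′ = false , pathEdge s (suc e′)
  rotate⁻ (false , bottomEdge s) = true , bottomEdge (prev s)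
  rotate⁻ (true  , bottomEdge s) = false , pathEdge (next s) zero
  rotate⁻ (false , topEdge s)    = true , pathEdge s (fromℕ (ℓ s))
  rotate⁻ (true  , topEdge s)    = false , topEdge (next s)

  faceOf : HalfEdge → Face
  faceOf (false , pathEdge s _) = lateral s
  faceOf (true  , pathEdge s _) = lateral (prev s)
  faceOf (false , bottomEdge _) = bottom
  faceOf (true  , bottomEdge s) = lateral s
  faceOf (false , topEdge s)    = lateral s
  faceOf (true  , topEdge _)    = top

  rotate-inject₁ : ∀ s e → rotate (true , pathEdge s (inject₁ e)) ≡ (false , pathEdge s (suc e))
  rotate-inject₁ s e rewrite view-inject₁ e = refl

  rotate-last : ∀ s → rotate (true , pathEdge s (fromℕ (ℓ s))) ≡ (false , topEdge s)
  rotate-last s rewrite view-fromℕ (ℓ s) = refl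

  rotate-rotate⁻ : ∀ d → rotate (rotate⁻ d) ≡ d
  rotate-rotate⁻ (false , pathEdge s zero)    = refl
  rotate-rotate⁻ (false , pathEdge s (suc e)) = rotate-inject₁ s e
  rotate-rotate⁻ (true  , pathEdge s e) with view e
  ... | ‵fromℕ      = cong (λ t → true , pathEdge t (fromℕ (ℓ t))) (next-prev s)
  ... | ‵inject₁ _  = refl
  rotate-rotate⁻ (false , bottomEdge s) = cong (λ t → false , bottomEdge t) (next-prev s)
  rotate-rotate⁻ (true  , bottomEdge s) = cong (λ t → true , bottomEdge t) (prev-next s)
  rotate-rotate⁻ (false , topEdge s)    = rotate-last s
  rotate-rotate⁻ (true  , topEdge s)    = cong (λ t → true , topEdge t) (prev-next s)

  rotate⁻-rotate : ∀ d → rotate⁻ (rotate d) ≡ d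
  rotate⁻-rotate (false , pathEdge s zero)    = cong (λ t → false , pathEdge t zero) (next-prev s)
  rotate⁻-rotate (false , pathEdge s (suc e)) rewrite view-inject₁ e = refl
  rotate⁻-rotate (true  , pathEdge s e) with view e
  ... | ‵fromℕ      = refl
  ... | ‵inject₁ _  = refl
  rotate⁻-rotate (false , bottomEdge s) = refl
  rotate⁻-rotate (true  , bottomEdge s) = cong (λ t → true , bottomEdge t) (prev-next s)
  rotate⁻-rotate (false , topEdge s)    = cong (λ t → false , topEdge t) (next-prev s)
  rotate⁻-rotate (true  , topEdge s)    rewrite view-fromℕ (ℓ (next s)) | prev-next s = refl

  vertexOf-rotate : ∀ d → vertexOf (rotate d) ≡ vertexOf d
  vertexOf-rotate (false , pathEdge s zero)    = cong (λ t → vx t zero) (next-prev s)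
  vertexOf-rotate (false , pathEdge s (suc e)) = refl
  vertexOf-rotate (true  , pathEdge s e) with view e
  ... | ‵fromℕ      = refl
  ... | ‵inject₁ _  = refl
  vertexOf-rotate (false , bottomEdge s) = refl
  vertexOf-rotate (true  , bottomEdge s) = refl
  vertexOf-rotate (false , topEdge s)    = cong (λ t → vx t (last t)) (next-prev s)
  vertexOf-rotate (true  , topEdge s)    = refl

  faceOf-rotate-opposite : ∀ d → faceOf (rotate (opposite d)) ≡ faceOf d
  faceOf-rotate-opposite (false , pathEdge s e) with view e
  ... | ‵fromℕ      = refl
  ... | ‵inject₁ _  = refl
  faceOf-rotate-opposite (true  , pathEdge s zero)    = refl
  faceOf-rotate-opposite (true  , pathEdge s (suc e)) = refl
  faceOf-rotate-opposite (false , bottomEdge s) = refl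
  faceOf-rotate-opposite (true  , bottomEdge s) = refl
  faceOf-rotate-opposite (false , topEdge s)    = cong lateral (prev-next s)
  faceOf-rotate-opposite (true  , topEdge s)    = refl

  vertexRoot : Vertex → HalfEdge
  vertexRoot (vx s zero)    = false , pathEdge s zero
  vertexRoot (vx s (suc i)) = true , pathEdge s i

  toVertexRoot : ∀ d → Star (Step rotate) d (vertexRoot (vertexOf d))
  toVertexRoot (false , pathEdge s zero)    = ε
  toVertexRoot (false , pathEdge s (suc e)) = refl ◅ ε
  toVertexRoot (true  , pathEdge s e)       = ε
  toVertexRoot (false , bottomEdge s)       = refl ◅ ε
  toVertexRoot (true  , bottomEdge s)       = refl ◅ refl ◅ ε
  toVertexRoot (false , topEdge 0F)         = refl ◅ refl ◅ ε
  toVertexRoot (false , topEdge 1F)         = refl ◅ refl ◅ ε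
  toVertexRoot (false , topEdge 2F)         = refl ◅ refl ◅ ε
  toVertexRoot (true  , topEdge s)          = refl ◅ ε

  fromVertexRoot : ∀ d → Star (Step rotate) (vertexRoot (vertexOf d)) d
  fromVertexRoot (false , pathEdge s zero)    = ε
  fromVertexRoot (false , pathEdge s (suc e)) = rotate-inject₁ s e ◅ ε
  fromVertexRoot (true  , pathEdge s e)       = ε
  fromVertexRoot (false , bottomEdge s)       = refl ◅ cong (λ t → false , bottomEdge t) (next-prev s) ◅ ε
  fromVertexRoot (true  , bottomEdge s)       = cong (λ t → true , bottomEdge t) (prev-next s) ◅ ε
  fromVertexRoot (false , topEdge s)          = rotate-last s ◅ ε
  fromVertexRoot (true  , topEdge s)          =
    rotate-last (next s) ◅ cong (λ t → true , topEdge t) (prev-next s) ◅ ε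

  vertex-orbit : ∀ d d′ → vertexOf d ≡ vertexOf d′ → Star (Step rotate) d d′
  vertex-orbit d d′ eq =
    toVertexRoot d ◅◅ subst (λ v → Star _ (vertexRoot v) d′) (sym eq) (fromVertexRoot d′)

  private
    FaceWalk : HalfEdge → HalfEdge → Set
    FaceWalk = Star (Step (rotate ∘ opposite))

  ascend : ∀ s e → FaceWalk (false , pathEdge s zero) (false , pathEdge s e)
  ascend s e = gmap (λ i → false , pathEdge s i) id
    (reverse id (walkDown e λ e′ _ → rotate-inject₁ s e′))

  ascendToTop : ∀ s e → FaceWalk (false , pathEdge s e) (false , pathEdge s (fromℕ (ℓ s)))
  ascendToTop s e = gmap (λ i → false , pathEdge s i) id
    (reverse id (walkDownFromLast e λ e′ _ → rotate-inject₁ s e′))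

  descend : ∀ s e → FaceWalk (true , pathEdge s e) (true , pathEdge s zero)
  descend s e = gmap (λ i → true , pathEdge s i) id (walkDown e λ _ _ → refl)

  descendFromTop : ∀ s e → FaceWalk (true , pathEdge s (fromℕ (ℓ s))) (true , pathEdge s e)
  descendFromTop s e = gmap (λ i → true , pathEdge s i) id (walkDownFromLast e λ _ _ → refl)

  faceRoot : Face → HalfEdge
  faceRoot (lateral s) = true , bottomEdge s
  faceRoot bottom      = false , bottomEdge 0F
  faceRoot top         = true , topEdge 0F

  topToRoot : ∀ s → FaceWalk (false , topEdge s) (faceRoot (lateral s))
  topToRoot s = refl ◅ descend (next s) _ ◅◅ cong (λ t → true , bottomEdge t) (prev-next s) ◅ ε

  rootToTop : ∀ s → FaceWalk (faceRoot (lateral s)) (false , topEdge s)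
  rootToTop s = refl ◅ ascendToTop s zero ◅◅ rotate-last s ◅ ε

  toFaceRoot : ∀ d → FaceWalk d (faceRoot (faceOf d))
  toFaceRoot (false , pathEdge s e)  = ascendToTop s e ◅◅ rotate-last s ◅ topToRoot s
  toFaceRoot (true  , pathEdge s e)  = descend s e ◅◅ refl ◅ ε
  toFaceRoot (false , bottomEdge 0F) = ε
  toFaceRoot (false , bottomEdge 1F) = refl ◅ refl ◅ ε
  toFaceRoot (false , bottomEdge 2F) = refl ◅ ε
  toFaceRoot (true  , bottomEdge s)  = ε
  toFaceRoot (false , topEdge s)     = topToRoot s
  toFaceRoot (true  , topEdge 0F)    = ε
  toFaceRoot (true  , topEdge 1F)    = refl ◅ ε
  toFaceRoot (true  , topEdge 2F)    = refl ◅ refl ◅ ε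

  fromFaceRoot : ∀ d → FaceWalk (faceRoot (faceOf d)) d
  fromFaceRoot (false , pathEdge s e)  = refl ◅ ascend s e
  fromFaceRoot (true  , pathEdge 0F e) = rootToTop 2F ◅◅ refl ◅ descendFromTop 0F e
  fromFaceRoot (true  , pathEdge 1F e) = rootToTop 0F ◅◅ refl ◅ descendFromTop 1F e
  fromFaceRoot (true  , pathEdge 2F e) = rootToTop 1F ◅◅ refl ◅ descendFromTop 2F e
  fromFaceRoot (false , bottomEdge 0F) = ε
  fromFaceRoot (false , bottomEdge 1F) = refl ◅ ε
  fromFaceRoot (false , bottomEdge 2F) = refl ◅ refl ◅ ε
  fromFaceRoot (true  , bottomEdge s)  = ε
  fromFaceRoot (false , topEdge s)     = rootToTop s
  fromFaceRoot (true  , topEdge 0F)    = ε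
  fromFaceRoot (true  , topEdge 1F)    = refl ◅ refl ◅ ε
  fromFaceRoot (true  , topEdge 2F)    = refl ◅ ε

  face-orbit : ∀ d d′ → faceOf d ≡ faceOf d′ → FaceWalk d d′
  face-orbit d d′ eq =
    toFaceRoot d ◅◅ subst (λ i → FaceWalk (faceRoot i) d′) (sym eq) (fromFaceRoot d′)

  prismMap : CombinatorialMap HalfEdge Vertex Face
  prismMap = record
    { opposite = opposite ; rotate = rotate ; rotate⁻ = rotate⁻
    ; vertexOf = vertexOf ; faceOf = faceOf
    ; opposite-involutive    = λ { (false , _) → refl ; (true , _) → refl }
    ; opposite-fixpointFree  = λ { (false , _) () ; (true , _) () }
    ; rotate-rotate⁻         = rotate-rotate⁻
    ; rotate⁻-rotate         = rotate⁻-rotate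
    ; vertexOf-rotate        = vertexOf-rotate
    ; vertex-orbit           = vertex-orbit
    ; faceOf-rotate-opposite = faceOf-rotate-opposite
    ; face-orbit             = face-orbit
    ; faceOf-surjective      = λ i → faceRoot i , faceOf-faceRoot i
    }
    where
    faceOf-faceRoot : ∀ i → faceOf (faceRoot i) ≡ i
    faceOf-faceRoot (lateral s) = refl
    faceOf-faceRoot bottom      = refl
    faceOf-faceRoot top         = refl

  open CombinatorialMap prismMap
    using ( Adjacent; AdjacentAvoiding; IncidentTo
          ; Adjacent-sym; AdjacentAvoiding-sym; AdjacentAvoiding-opposite)

  toOrigin : ∀ v → Star Adjacent v (vx 0F zero)
  toOrigin (vx s i) =
    gmap (vx s) id (walkDown i λ e _ → (true , pathEdge s e) , refl , refl) ◅◅ acrossBottom s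
    where
    acrossBottom : ∀ s → Star Adjacent (vx s zero) (vx 0F zero)
    acrossBottom 0F = ε
    acrossBottom 1F = ((true , bottomEdge 0F) , refl , refl) ◅ ε
    acrossBottom 2F = ((false , bottomEdge 2F) , refl , refl) ◅ ε

  walk : ∀ u v → Star Adjacent u v
  walk u v = toOrigin u ◅◅ reverse Adjacent-sym (toOrigin v)

  private
    hop : ∀ {e} d → d ≢ e → d ≢ opposite e → AdjacentAvoiding e (vertexOf d) (vertexOf (opposite d))
    hop d d≢e d≢αe = d , d≢e , d≢αe , refl , refl

    edgeSide : HalfEdge → Fin 3
    edgeSide (_ , pathEdge s _) = s
    edgeSide (_ , bottomEdge s) = s
    edgeSide (_ , topEdge s)    = s

  -- Down path s, across the bottom, up path next s, across the top and down path s again.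
  pathEdgeDetour : ∀ s e → Star (AdjacentAvoiding (false , pathEdge s e)) (vx s (inject₁ e)) (vx s (suc e))
  pathEdgeDetour s e =
    gmap (vx s) id (walkDown (inject₁ e) λ e′ e′<e →
      hop (true , pathEdge s e′) (λ ()) λ { refl → <-irrefl (sym (toℕ-inject₁ e′)) e′<e })
    ◅◅ hop (false , bottomEdge s) (λ ()) (λ ())
    ◅ gmap (vx (next s)) id (reverse id (walkDownFromLast zero λ e′ _ →
        hop (false , pathEdge (next s) e′) (next≢id s ∘ cong edgeSide) (next≢id s ∘ cong edgeSide)))
    ◅◅ hop (true , topEdge s) (λ ()) (λ ())
    ◅ gmap (vx s) id (walkDownFromLast (suc e) λ e′ e<e′ →
        hop (true , pathEdge s e′) (λ ()) λ { refl → <-irrefl refl e<e′ })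

  forwardDetour : ∀ e → Star (AdjacentAvoiding (false , e)) (vertexOf (false , e)) (vertexOf (true , e))
  forwardDetour (pathEdge s e) = pathEdgeDetour s e
  forwardDetour (bottomEdge 0F) =
    hop (true , bottomEdge 2F) (λ ()) (λ ()) ◅ hop (true , bottomEdge 1F) (λ ()) (λ ()) ◅ ε
  forwardDetour (bottomEdge 1F) =
    hop (true , bottomEdge 0F) (λ ()) (λ ()) ◅ hop (true , bottomEdge 2F) (λ ()) (λ ()) ◅ ε
  forwardDetour (bottomEdge 2F) =
    hop (true , bottomEdge 1F) (λ ()) (λ ()) ◅ hop (true , bottomEdge 0F) (λ ()) (λ ()) ◅ ε
  forwardDetour (topEdge 0F) =
    hop (true , topEdge 2F) (λ ()) (λ ()) ◅ hop (true , topEdge 1F) (λ ()) (λ ()) ◅ ε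
  forwardDetour (topEdge 1F) =
    hop (true , topEdge 0F) (λ ()) (λ ()) ◅ hop (true , topEdge 2F) (λ ()) (λ ()) ◅ ε
  forwardDetour (topEdge 2F) =
    hop (true , topEdge 1F) (λ ()) (λ ()) ◅ hop (true , topEdge 0F) (λ ()) (λ ()) ◅ ε

  detour : ∀ d → Star (AdjacentAvoiding d) (vertexOf d) (vertexOf (opposite d))
  detour (false , e) = forwardDetour e
  detour (true  , e) = reverse (AdjacentAvoiding-sym ∘ AdjacentAvoiding-opposite) (forwardDetour e)

  private
    pathOf : Vertex → Fin 3
    pathOf (vx s _) = s

    vx-injective : ∀ {s i j} → vx s i ≡ vx s j → i ≡ j
    vx-injective refl = refl

  noLoop : ∀ d → vertexOf d ≢ vertexOf (opposite d)
  noLoop (false , pathEdge s e) = inject₁≢suc e ∘ vx-injective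
  noLoop (true  , pathEdge s e) = inject₁≢suc e ∘ sym ∘ vx-injective
  noLoop (false , bottomEdge s) = next≢id s ∘ sym ∘ cong pathOf
  noLoop (true  , bottomEdge s) = next≢id s ∘ cong pathOf
  noLoop (false , topEdge s)    = next≢id s ∘ sym ∘ cong pathOf
  noLoop (true  , topEdge s)    = next≢id s ∘ cong pathOf

  successor? : ∀ {n} → Fin (suc n) → Fin (suc n) → Maybe (Fin n)
  successor? {suc n} zero    (suc zero) = just zero
  successor? {suc n} (suc i) (suc j)    = Maybe.map suc (successor? i j)
  successor?         _       _          = nothing

  successor?-inject₁-suc : ∀ {n} (e : Fin n) → successor? (inject₁ e) (suc e) ≡ just e
  successor?-inject₁-suc {suc n} zero    = refl
  successor?-inject₁-suc {suc n} (suc e) = cong (Maybe.map suc) (successor?-inject₁-suc e)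

  successor?-suc-inject₁ : ∀ {n} (e : Fin n) → successor? (suc e) (inject₁ e) ≡ nothing
  successor?-suc-inject₁ {suc n} zero    = refl
  successor?-suc-inject₁ {suc n} (suc e) = cong (Maybe.map suc) (successor?-suc-inject₁ e)

  halfEdgeBetween : Vertex → Vertex → Maybe HalfEdge
  halfEdgeBetween (vx s i) (vx t j) with s ≟ᶠ t
  ... | yes refl = along s (successor? i j) (successor? j i)
    where
    along : ∀ s → Maybe (Fin (edges s)) → Maybe (Fin (edges s)) → Maybe HalfEdge
    along s (just e) _        = just (false , pathEdge s e)
    along s nothing  (just e) = just (true , pathEdge s e)
    along s nothing  nothing  = nothing
  ... | no _ with does (t ≟ᶠ next s) | i
  ...   | true  | zero  = just (false , bottomEdge s)
  ...   | true  | suc _ = just (false , topEdge s)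
  ...   | false | zero  = just (true , bottomEdge t)
  ...   | false | suc _ = just (true , topEdge t)

  halfEdgeBetween-endpoints : ∀ d → halfEdgeBetween (vertexOf d) (vertexOf (opposite d)) ≡ just d
  halfEdgeBetween-endpoints (false , pathEdge s e) with s ≟ᶠ s
  ... | yes refl rewrite successor?-inject₁-suc e = refl
  ... | no  s≢s  = contradiction refl s≢s
  halfEdgeBetween-endpoints (true  , pathEdge s e) with s ≟ᶠ s
  ... | yes refl rewrite successor?-suc-inject₁ e | successor?-inject₁-suc e = refl
  ... | no  s≢s  = contradiction refl s≢s
  halfEdgeBetween-endpoints (false , bottomEdge 0F) = refl
  halfEdgeBetween-endpoints (false , bottomEdge 1F) = refl
  halfEdgeBetween-endpoints (false , bottomEdge 2F) = refl
  halfEdgeBetween-endpoints (true  , bottomEdge 0F) = refl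
  halfEdgeBetween-endpoints (true  , bottomEdge 1F) = refl
  halfEdgeBetween-endpoints (true  , bottomEdge 2F) = refl
  halfEdgeBetween-endpoints (false , topEdge 0F)    = refl
  halfEdgeBetween-endpoints (false , topEdge 1F)    = refl
  halfEdgeBetween-endpoints (false , topEdge 2F)    = refl
  halfEdgeBetween-endpoints (true  , topEdge 0F)    = refl
  halfEdgeBetween-endpoints (true  , topEdge 1F)    = refl
  halfEdgeBetween-endpoints (true  , topEdge 2F)    = refl

  noMultiEdge : ∀ d d′ → vertexOf d ≡ vertexOf d′ → vertexOf (opposite d) ≡ vertexOf (opposite d′) → d ≡ d′
  noMultiEdge d d′ tails heads = just-injective (begin
    just d                                              ≡⟨ sym (halfEdgeBetween-endpoints d) ⟩
    halfEdgeBetween (vertexOf d) (vertexOf (opposite d))   ≡⟨ cong₂ halfEdgeBetween tails heads ⟩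
    halfEdgeBetween (vertexOf d′) (vertexOf (opposite d′)) ≡⟨ halfEdgeBetween-endpoints d′ ⟩
    just d′                                             ∎)
    where open ≡-Reasoning

  onFace : Face → Vertex → Bool
  onFace (lateral t) (vx s _) = does (s ≟ᶠ t) ∨ does (s ≟ᶠ next t)
  onFace bottom      (vx _ i) = toℕ i ≡ᵇ 0
  onFace top         (vx s i) = toℕ i ≡ᵇ edges s

  onFace-faceOf : ∀ d → T (onFace (faceOf d) (vertexOf d))
  onFace-faceOf (false , pathEdge 0F _) = _
  onFace-faceOf (false , pathEdge 1F _) = _
  onFace-faceOf (false , pathEdge 2F _) = _
  onFace-faceOf (true  , pathEdge 0F _) = _
  onFace-faceOf (true  , pathEdge 1F _) = _
  onFace-faceOf (true  , pathEdge 2F _) = _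
  onFace-faceOf (false , bottomEdge _)  = _
  onFace-faceOf (true  , bottomEdge 0F) = _
  onFace-faceOf (true  , bottomEdge 1F) = _
  onFace-faceOf (true  , bottomEdge 2F) = _
  onFace-faceOf (false , topEdge 0F)    = _
  onFace-faceOf (false , topEdge 1F)    = _
  onFace-faceOf (false , topEdge 2F)    = _
  onFace-faceOf (true  , topEdge s)     = ≡⇒≡ᵇ _ _ (toℕ-fromℕ (edges (next s)))

  onOwnPath : ∀ t p → IncidentTo (vx t p) (lateral t)
  onOwnPath t p with view p
  ... | ‵fromℕ     = (false , topEdge t) , refl , refl
  ... | ‵inject₁ e = (false , pathEdge t e) , refl , refl

  onNextPath : ∀ t p → IncidentTo (vx (next t) p) (lateral t)
  onNextPath t zero    = (true , bottomEdge t) , refl , refl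
  onNextPath t (suc e) = (true , pathEdge (next t) e) , cong lateral (prev-next t) , refl

  onFace⇒incident : ∀ i v → T (onFace i v) → IncidentTo v i
  onFace⇒incident (lateral 0F) (vx 0F p) _ = onOwnPath 0F p
  onFace⇒incident (lateral 0F) (vx 1F p) _ = onNextPath 0F p
  onFace⇒incident (lateral 0F) (vx 2F p) ()
  onFace⇒incident (lateral 1F) (vx 0F p) ()
  onFace⇒incident (lateral 1F) (vx 1F p) _ = onOwnPath 1F p
  onFace⇒incident (lateral 1F) (vx 2F p) _ = onNextPath 1F p
  onFace⇒incident (lateral 2F) (vx 2F p) _ = onOwnPath 2F p
  onFace⇒incident (lateral 2F) (vx 0F p) _ = onNextPath 2F p
  onFace⇒incident (lateral 2F) (vx 1F p) ()
  onFace⇒incident bottom       (vx s zero) _ = (false , bottomEdge s) , refl , refl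
  onFace⇒incident top          (vx s p) p≡last =
    (true , topEdge (prev s)) , refl ,
    trans (cong (λ t → vx t (last t)) (next-prev s))
          (cong (vx s) (toℕ-injective (trans (toℕ-fromℕ (edges s)) (sym (≡ᵇ⇒≡ _ _ p≡last)))))

  incident⇔onFace : ∀ v i → IncidentTo v i ⇔ T (onFace i v)
  incident⇔onFace v i = mk⇔ (λ { (d , refl , refl) → onFace-faceOf d }) (onFace⇒incident i v)

  vertexCount : ℕ
  vertexCount = suc (edges 0F) + (suc (edges 1F) + suc (edges 2F))

  vertex↔ : Vertex ↔ Fin vertexCount
  vertex↔ = ↔-trans (mk↔ₛ′ to from to-from from-to) (↔-refl ⊎-Fin (↔-refl ⊎-Fin ↔-refl))
    where
    to : Vertex → Fin (suc (edges 0F)) ⊎ (Fin (suc (edges 1F)) ⊎ Fin (suc (edges 2F)))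
    to (vx 0F i) = inj₁ i
    to (vx 1F i) = inj₂ (inj₁ i)
    to (vx 2F i) = inj₂ (inj₂ i)
    from : Fin (suc (edges 0F)) ⊎ (Fin (suc (edges 1F)) ⊎ Fin (suc (edges 2F))) → Vertex
    from (inj₁ i)        = vx 0F i
    from (inj₂ (inj₁ i)) = vx 1F i
    from (inj₂ (inj₂ i)) = vx 2F i
    to-from : ∀ x → to (from x) ≡ x
    to-from (inj₁ _)        = refl
    to-from (inj₂ (inj₁ _)) = refl
    to-from (inj₂ (inj₂ _)) = refl
    from-to : ∀ v → from (to v) ≡ v
    from-to (vx 0F _) = refl
    from-to (vx 1F _) = refl
    from-to (vx 2F _) = refl

  edge↔ : Edge ↔ Fin (edges 0F + (edges 1F + (edges 2F + (3 + 3))))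
  edge↔ = ↔-trans (mk↔ₛ′ to from to-from from-to)
                  (↔-refl ⊎-Fin (↔-refl ⊎-Fin (↔-refl ⊎-Fin (↔-refl ⊎-Fin ↔-refl))))
    where
    to : Edge → Fin (edges 0F) ⊎ (Fin (edges 1F) ⊎ (Fin (edges 2F) ⊎ (Fin 3 ⊎ Fin 3)))
    to (pathEdge 0F e) = inj₁ e
    to (pathEdge 1F e) = inj₂ (inj₁ e)
    to (pathEdge 2F e) = inj₂ (inj₂ (inj₁ e))
    to (bottomEdge s)  = inj₂ (inj₂ (inj₂ (inj₁ s)))
    to (topEdge s)     = inj₂ (inj₂ (inj₂ (inj₂ s)))
    from : Fin (edges 0F) ⊎ (Fin (edges 1F) ⊎ (Fin (edges 2F) ⊎ (Fin 3 ⊎ Fin 3))) → Edge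
    from (inj₁ e)                        = pathEdge 0F e
    from (inj₂ (inj₁ e))                 = pathEdge 1F e
    from (inj₂ (inj₂ (inj₁ e)))          = pathEdge 2F e
    from (inj₂ (inj₂ (inj₂ (inj₁ s))))   = bottomEdge s
    from (inj₂ (inj₂ (inj₂ (inj₂ s))))   = topEdge s
    to-from : ∀ x → to (from x) ≡ x
    to-from (inj₁ _)                      = refl
    to-from (inj₂ (inj₁ _))               = refl
    to-from (inj₂ (inj₂ (inj₁ _)))        = refl
    to-from (inj₂ (inj₂ (inj₂ (inj₁ _)))) = refl
    to-from (inj₂ (inj₂ (inj₂ (inj₂ _)))) = refl
    from-to : ∀ e → from (to e) ≡ e
    from-to (pathEdge 0F _) = refl
    from-to (pathEdge 1F _) = refl
    from-to (pathEdge 2F _) = refl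
    from-to (bottomEdge _)  = refl
    from-to (topEdge _)     = refl

  edgeCount : ℕ
  edgeCount = edges 0F + (edges 1F + (edges 2F + (3 + 3)))

  halfEdge↔ : HalfEdge ↔ Fin (2 * edgeCount)
  halfEdge↔ = ↔-trans (↔-sym 2↔Bool ×-↔ edge↔) (↔-sym *↔×)

  face↔ : Face ↔ Fin (3 + 2)
  face↔ = ↔-trans (mk↔ₛ′ to from to-from from-to) (↔-refl ⊎-Fin ↔-refl)
    where
    to : Face → Fin 3 ⊎ Fin 2
    to (lateral s) = inj₁ s
    to bottom      = inj₂ 0F
    to top         = inj₂ 1F
    from : Fin 3 ⊎ Fin 2 → Face
    from (inj₁ s)  = lateral s
    from (inj₂ 0F) = bottom
    from (inj₂ 1F) = top
    to-from : ∀ x → to (from x) ≡ x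
    to-from (inj₁ _)  = refl
    to-from (inj₂ 0F) = refl
    to-from (inj₂ 1F) = refl
    from-to : ∀ i → from (to i) ≡ i
    from-to (lateral _) = refl
    from-to bottom      = refl
    from-to top         = refl

  private
    module E = Encoding prismMap {m = edgeCount} halfEdge↔ vertex↔ face↔

  prism : Map
  prism = E.encoded

  vertexIndex : Vertex → Fin vertexCount
  vertexIndex = Inverse.to vertex↔

  vertexAt : Fin vertexCount → Vertex
  vertexAt = Inverse.from vertex↔

  faceIndex : Face → Fin (3 + 2)
  faceIndex = Inverse.to face↔

  prism-isPlane : IsPlane prism
  prism-isPlane = E.connected walk , euler (ℓ 0F) (ℓ 1F) (ℓ 2F)
    where
    euler : ∀ a b c → 2 + a + (2 + b + (2 + c)) + (3 + 2) ≡ 1 + a + (1 + b + (1 + c + (3 + 3))) + 2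
    euler = solve-∀

  prism-simple : Simple prism
  prism-simple = E.simple noLoop noMultiEdge

  prism-twoEdgeConnected : TwoEdgeConnected prism
  prism-twoEdgeConnected = E.twoEdgeConnected walk detour

  vertexSum : (Vertex → Bool) → ℕ
  vertexSum p = count (p ∘ vx 0F) + (count (p ∘ vx 1F) + count (p ∘ vx 2F))

  count-vertexAt : ∀ p → count (p ∘ vertexAt) ≡ vertexSum p
  count-vertexAt p =
    trans (count-↑ (suc (edges 0F)) {suc (edges 1F) + suc (edges 2F)} (p ∘ vertexAt))
          (cong₂ _+_ (back 0F)
                     (trans (count-↑ (suc (edges 1F)) {suc (edges 2F)} (λ i → p (vertexAt (suc (edges 0F) ↑ʳ i))))
                            (cong₂ _+_ (back 1F) (back 2F))))
    where
    back : ∀ s → count (p ∘ vertexAt ∘ vertexIndex ∘ vx s) ≡ count (p ∘ vx s)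
    back s = count-cong λ i → cong p (Inverse.strictlyInverseʳ vertex↔ (vx s i))

  countColour-prism : ∀ col i c → countColour prism col (faceIndex i) c ≡
                                  vertexSum (λ v → onFace i v ∧ (col (vertexIndex v) ≡ᵇ c))
  countColour-prism col i c = begin
    countColour prism col (faceIndex i) c
      ≡⟨ E.countColour-encoded onFace incident⇔onFace col (faceIndex i) c ⟩
    count (λ x → onFace (Inverse.from face↔ (faceIndex i)) (vertexAt x) ∧ (col x ≡ᵇ c))
      ≡⟨ count-cong (λ x → cong₂ (λ j y → onFace j (vertexAt x) ∧ (col y ≡ᵇ c))
                                 (Inverse.strictlyInverseʳ face↔ i)
                                 (sym (Inverse.strictlyInverseˡ vertex↔ x))) ⟩
    count ((λ v → onFace i v ∧ (col (vertexIndex v) ≡ᵇ c)) ∘ vertexAt)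
      ≡⟨ count-vertexAt (λ v → onFace i v ∧ (col (vertexIndex v) ≡ᵇ c)) ⟩
    vertexSum (λ v → onFace i v ∧ (col (vertexIndex v) ≡ᵇ c)) ∎
    where open ≡-Reasoning

  countColour-lateral : ∀ col t c →
                        countColour prism col (faceIndex (lateral t)) c ≡
                        occurrences (col ∘ vertexIndex ∘ vx t) c + occurrences (col ∘ vertexIndex ∘ vx (next t)) c
  countColour-lateral col t c = trans (countColour-prism col (lateral t) c) (sides t)
    where
    X : Fin 3 → ℕ
    X s = occurrences (col ∘ vertexIndex ∘ vx s) c
    sides : ∀ t → vertexSum (λ v → onFace (lateral t) v ∧ (col (vertexIndex v) ≡ᵇ c)) ≡ X t + X (next t)
    sides 0F = cong (X 0F +_) (trans (cong (X 1F +_) (count-false {suc (edges 2F)})) (+-identityʳ (X 1F)))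
    sides 1F = cong (_+ (X 1F + X 2F)) (count-false {suc (edges 0F)})
    sides 2F = trans (cong (λ z → X 0F + (z + X 2F)) (count-false {suc (edges 1F)})) (+-comm (X 0F) (X 2F))

  countColour-bottom : ∀ col c → countColour prism col (faceIndex bottom) c ≡
                                 count (λ s → col (vertexIndex (vx s zero)) ≡ᵇ c)
  countColour-bottom col c = trans (countColour-prism col bottom c)
    (cong₂ _+_ (first 0F) (cong₂ _+_ (first 1F) (trans (first 2F) (sym (+-identityʳ _)))))
    where
    first : ∀ s → count (λ i → (toℕ i ≡ᵇ 0) ∧ (col (vertexIndex (vx s i)) ≡ᵇ c)) ≡
                  ⟦ col (vertexIndex (vx s zero)) ≡ᵇ c ⟧
    first s = count-first (λ i → col (vertexIndex (vx s i)) ≡ᵇ c)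

  countColour-top : ∀ col c → countColour prism col (faceIndex top) c ≡
                              count (λ s → col (vertexIndex (vx s (last s))) ≡ᵇ c)
  countColour-top col c = trans (countColour-prism col top c)
    (cong₂ _+_ (final 0F) (cong₂ _+_ (final 1F) (trans (final 2F) (sym (+-identityʳ _)))))
    where
    final : ∀ s → count (λ i → (toℕ i ≡ᵇ edges s) ∧ (col (vertexIndex (vx s i)) ≡ᵇ c)) ≡
                  ⟦ col (vertexIndex (vx s (last s))) ≡ᵇ c ⟧
    final s = count-last (edges s) (λ i → col (vertexIndex (vx s i)) ≡ᵇ c)

  private
    halfEdgeIndex : HalfEdge → Fin (2 * edgeCount)
    halfEdgeIndex = Inverse.to halfEdge↔

  proper⇒properPaths : ∀ {col} → (∀ x → col (vert prism x) ≢ col (vert prism (α prism x))) →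
                ∀ s → ProperPath (col ∘ vertexIndex ∘ vx s)
  proper⇒properPaths {col} proper s e eq = proper (halfEdgeIndex (false , pathEdge s e))
    (trans (cong col (E.vert-to (false , pathEdge s e)))
           (trans eq (sym (cong col (E.vert-α-to (false , pathEdge s e))))))

  disjointPaths⇒FPColouring : (κ : Vertex → ℕ) → (∀ s → ProperPath (κ ∘ vx s)) →
                (∀ s c → ZeroOrOdd (occurrences (κ ∘ vx s) c)) →
                (∀ {s t} i j → s ≢ t → κ (vx s i) ≢ κ (vx t j)) →
                IsFPColouring prism (κ ∘ vertexAt)
  disjointPaths⇒FPColouring κ proper zeroOrOdd disjoint = properAt , parityAt
    where
    κ-vertexAt : ∀ v → κ (vertexAt (vertexIndex v)) ≡ κ v
    κ-vertexAt v = cong κ (Inverse.strictlyInverseʳ vertex↔ v)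

    properHalfEdge : ∀ d → κ (vertexOf d) ≢ κ (vertexOf (opposite d))
    properHalfEdge (false , pathEdge s e) = proper s e
    properHalfEdge (true  , pathEdge s e) = proper s e ∘ sym
    properHalfEdge (false , bottomEdge s) = disjoint _ _ (next≢id s ∘ sym)
    properHalfEdge (true  , bottomEdge s) = disjoint _ _ (next≢id s)
    properHalfEdge (false , topEdge s)    = disjoint _ _ (next≢id s ∘ sym)
    properHalfEdge (true  , topEdge s)    = disjoint _ _ (next≢id s)

    properAt : ∀ x → κ (vertexAt (vert prism x)) ≢ κ (vertexAt (vert prism (α prism x)))
    properAt x eq = properHalfEdge (Inverse.from halfEdge↔ x)
      (trans (sym (κ-vertexAt _)) (trans eq (trans (cong (κ ∘ vertexAt) (E.vert-α x)) (κ-vertexAt _))))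

    occurrences-κ : ∀ s c → occurrences (κ ∘ vertexAt ∘ vertexIndex ∘ vx s) c ≡ occurrences (κ ∘ vx s) c
    occurrences-κ s = occurrences-cong (κ-vertexAt ∘ vx s)

    triangle : (corner : ∀ s → Fin (suc (edges s))) → ∀ c →
               ZeroOrOdd (count (λ s → κ (vertexAt (vertexIndex (vx s (corner s)))) ≡ᵇ c))
    triangle corner c = ≤1⇒zeroOrOdd (count≤1 _ λ s t κs≡c κt≡c → decidable-stable (s ≟ᶠ t) λ s≢t →
      disjoint (corner s) (corner t) s≢t
        (trans (sym (κ-vertexAt _)) (trans (≡ᵇ⇒≡ _ _ κs≡c) (trans (sym (≡ᵇ⇒≡ _ _ κt≡c)) (κ-vertexAt _)))))

    parityOn : ∀ f c → ZeroOrOdd (countColour prism (κ ∘ vertexAt) (faceIndex f) c)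
    parityOn (lateral t) c = subst ZeroOrOdd
      (sym (trans (countColour-lateral (κ ∘ vertexAt) t c)
                  (cong₂ _+_ (occurrences-κ t c) (occurrences-κ (next t) c))))
      (zeroOrOdd-+ (zeroOrOdd t c) (zeroOrOdd (next t) c)
        (occurrences-disjoint _ _ (λ i j → disjoint i j (next≢id t ∘ sym)) c))
    parityOn bottom c =
      subst ZeroOrOdd (sym (countColour-bottom (κ ∘ vertexAt) c)) (triangle (λ _ → zero) c)
    parityOn top c =
      subst ZeroOrOdd (sym (countColour-top (κ ∘ vertexAt) c)) (triangle last c)

    parityAt : ∀ j c → ZeroOrOdd (countColour prism (κ ∘ vertexAt) j c)
    parityAt j c = subst (λ j → ZeroOrOdd (countColour prism (κ ∘ vertexAt) j c))
                         (Inverse.strictlyInverseˡ face↔ j) (parityOn (Inverse.from face↔ j) c)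

-- The prisms of the theorem

x+[y+w]≤1 : ∀ {x y z w} → (z ≡ 0 → x + y ≤ 1) → (z ≡ 0 → w ≡ 0) → (0 < z → x + y ≡ 0) → w ≤ 1 →
            x + (y + w) ≤ 1
x+[y+w]≤1 {x} {y} {zero}  x+y≤1 w≡0 _     _   rewrite w≡0 refl | +-identityʳ y = x+y≤1 refl
x+[y+w]≤1 {x} {y} {suc z} _     _   x+y≡0 w≤1
  rewrite m+n≡0⇒m≡0 x (x+y≡0 (s≤s z≤n)) | m+n≡0⇒n≡0 x (x+y≡0 (s≤s z≤n)) = w≤1

alternate : ℕ → ℕ → ∀ {n} → Fin n → ℕ
alternate a b zero          = a
alternate a b (suc zero)    = b
alternate a b (suc (suc i)) = alternate a b i

alternate-proper : ∀ {a b n} → a ≢ b → ProperPath {n} (alternate a b)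
alternate-proper a≢b zero          = a≢b
alternate-proper a≢b (suc zero)    = a≢b ∘ sym
alternate-proper a≢b (suc (suc e)) = alternate-proper a≢b e

alternate-values : ∀ {a b n} (i : Fin n) → alternate a b i ≡ a ⊎ alternate a b i ≡ b
alternate-values zero          = inj₁ refl
alternate-values (suc zero)    = inj₂ refl
alternate-values (suc (suc i)) = alternate-values i

-- For k = j + 3 the three paths have 4, 4 and 4 (j + 1) vertices.
lengths : ℕ → Fin 3 → ℕ
lengths j 0F = 2
lengths j 1F = 2
lengths j 2F = 2 + j * 2 * 2

module Witness (j : ℕ) where

  open Prism (lengths j) public

  colouring : Vertex → ℕ
  colouring (vx 0F i)             = toℕ i
  colouring (vx 1F i)             = 4 + toℕ i
  colouring (vx 2F zero)          = 10
  colouring (vx 2F (suc zero))    = 11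
  colouring (vx 2F (suc (suc i))) = alternate 8 9 i

  colouring-block : ∀ s i → toℕ s * 4 ≤ colouring (vx s i) × colouring (vx s i) < suc (toℕ s) * 4
  colouring-block 0F i                   = z≤n , toℕ<n i
  colouring-block 1F i                   = m≤m+n 4 (toℕ i) , +-monoʳ-< 4 (toℕ<n i)
  colouring-block 2F zero                = m≤m+n 8 2 , m≤m+n 11 1
  colouring-block 2F (suc zero)          = m≤m+n 8 3 , ≤-refl
  colouring-block 2F (suc (suc i)) with alternate 8 9 i | alternate-values {8} {9} i
  ... | _ | inj₁ refl = ≤-refl , m≤m+n 9 3
  ... | _ | inj₂ refl = n≤1+n 8 , m≤m+n 10 2

  colouring-disjoint : ∀ {s t} i k → s ≢ t → colouring (vx s i) ≢ colouring (vx t k)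
  colouring-disjoint {s} {t} i k s≢t eq = s≢t (toℕ-injective (≤-antisym
    (sameBlock (proj₁ (colouring-block s i)) (subst (_< _) (sym eq) (proj₂ (colouring-block t k))))
    (sameBlock (proj₁ (colouring-block t k)) (subst (_< _) eq (proj₂ (colouring-block s i))))))
    where
    sameBlock : ∀ {a b x} → a * 4 ≤ x → x < suc b * 4 → a ≤ b
    sameBlock a4≤x x<b4 = s≤s⁻¹ (*-cancelʳ-< 4 _ _ (≤-<-trans a4≤x x<b4))

  colouring<12 : ∀ v → colouring v < 12
  colouring<12 (vx s i) = <-≤-trans (proj₂ (colouring-block s i)) (*-monoˡ-≤ 4 (toℕ<n s))

  colouring-proper : ∀ s → ProperPath (colouring ∘ vx s)
  colouring-proper 0F e                   = inject₁≢suc e ∘ toℕ-injective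
  colouring-proper 1F e                   = inject₁≢suc e ∘ toℕ-injective ∘ +-cancelˡ-≡ 4 _ _
  colouring-proper 2F zero                = λ ()
  colouring-proper 2F (suc zero)          = λ ()
  colouring-proper 2F (suc (suc e))       = alternate-proper (λ ()) e

  colouring-zeroOrOdd : ∀ s c → ZeroOrOdd (occurrences (colouring ∘ vx s) c)
  colouring-zeroOrOdd 0F = injective⇒zeroOrOdd (colouring ∘ vx 0F) toℕ-injective
  colouring-zeroOrOdd 1F = injective⇒zeroOrOdd (colouring ∘ vx 1F) (toℕ-injective ∘ +-cancelˡ-≡ 4 _ _)
  colouring-zeroOrOdd 2F c with c ≟ 8 | c ≟ 9
  ... | yes refl | _        = subst ZeroOrOdd
    (sym (occurrences-twoColouredPath (j * 2) (alternate 8 9) (alternate-proper (λ ())) alternate-values))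
    (inj₂ (j , cong suc (*-comm j 2)))
  ... | no _     | yes refl = subst ZeroOrOdd
    (sym (occurrences-twoColouredPath (j * 2) (alternate 8 9) (alternate-proper (λ ()))
                                      (Sum.swap ∘ alternate-values)))
    (inj₂ (j , cong suc (*-comm j 2)))
  ... | no c≢8   | no c≢9   = ≤1⇒zeroOrOdd
    (subst (λ z → ⟦ 10 ≡ᵇ c ⟧ + (⟦ 11 ≡ᵇ c ⟧ + z) ≤ 1) (sym alternate-absent)
           (≤-trans (≤-reflexive (cong (⟦ 10 ≡ᵇ c ⟧ +_) (+-identityʳ _)))
                    (distinct-indicators≤1 {10} {11} c λ ())))
    where
    alternate-absent : occurrences (alternate 8 9 {2 + j * 2 * 2}) c ≡ 0
    alternate-absent = count-none {2 + j * 2 * 2} (λ i → alternate 8 9 i ≡ᵇ c) λ i t → Sum.[ c≢8 , c≢9 ]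
      (Sum.map (trans (sym (≡ᵇ⇒≡ _ _ t))) (trans (sym (≡ᵇ⇒≡ _ _ t))) (alternate-values i))

  colouring-fp : IsFPColouring prism (colouring ∘ vertexAt)
  colouring-fp = disjointPaths⇒FPColouring colouring colouring-proper colouring-zeroOrOdd colouring-disjoint

  module _ {col : Fin vertexCount → ℕ} (fp : IsFPColouring prism col) where

    private
      κ : Vertex → ℕ
      κ = col ∘ vertexIndex

      occ : Fin 3 → ℕ → ℕ
      occ s = occurrences (κ ∘ vx s)

      proper : ∀ s → ProperPath (κ ∘ vx s)
      proper = proper⇒properPaths {col} (proj₁ fp)

    lateralParity : ∀ t c → ZeroOrOdd (occ t c + occ (next t) c)
    lateralParity t c = subst ZeroOrOdd (countColour-lateral col t c) (proj₂ fp (faceIndex (lateral t)) c)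

    shortPaths-vanish : ∀ c → 0 < occ 2F c → occ 0F c + occ 1F c ≡ 0
    shortPaths-vanish c =
      pairedCounts-vanish {occ 0F c} {occ 1F c} {occ 2F c} (lateralParity 0F c) (lateralParity 1F c)
                            (subst ZeroOrOdd (+-comm (occ 2F c) (occ 0F c)) (lateralParity 2F c))

    shortPaths≤1 : ∀ c → occ 2F c ≡ 0 → occ 0F c + occ 1F c ≤ 1
    shortPaths≤1 c absent = pairedCounts≤1 {occ 0F c} {occ 1F c}
      (occurrences-evenPath≤ 1 (κ ∘ vx 0F) (proper 0F) c)
      (occurrences-evenPath≤ 1 (κ ∘ vx 1F) (proper 1F) c)
      (subst (λ z → ZeroOrOdd (z + occ 0F c)) absent (lateralParity 2F c))
      (subst ZeroOrOdd (trans (cong (occ 1F c +_) absent) (+-identityʳ _)) (lateralParity 1F c))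
      (lateralParity 0F c)

    occurring : ∀ {c i} → κ (vx 2F i) ≡ c → 0 < occ 2F c
    occurring {c} {i} κi≡c = count-positive (λ k → κ (vx 2F k) ≡ᵇ c) i (≡⇒≡ᵇ _ c κi≡c)

    longPath-odd : ∀ i → Odd (occ 2F (κ (vx 2F i)))
    longPath-odd i = zeroOrOdd-positive {occ 2F c}
      (subst (λ y → ZeroOrOdd (y + occ 2F c))
             (m+n≡0⇒n≡0 (occ 0F c) {occ 1F c} (shortPaths-vanish c present))
             (lateralParity 1F c))
      present
      where
      c = κ (vx 2F i)
      present : 0 < occ 2F c
      present = occurring {c} {i} refl

    shortPaths+long≤numColours : ∀ is → Unique (map (κ ∘ vx 2F) is) → 8 + length is ≤ numColours prism col
    shortPaths+long≤numColours is zs! =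
      subst (_≤ numColours prism col) (cong (8 +_) (length-map (κ ∘ vx 2F) is))
            (length≤numColours prism col (multiplicity≤1⇒Unique ds atMostOnce) used)
      where
      xs ys zs ds : List ℕ
      xs = tabulate (κ ∘ vx 0F)
      ys = tabulate (κ ∘ vx 1F)
      zs = map (κ ∘ vx 2F) is
      ds = xs ++ ys ++ zs

      multiplicity-ds : ∀ c → multiplicity c ds ≡ occ 0F c + (occ 1F c + multiplicity c zs)
      multiplicity-ds c = trans (multiplicity-++ c xs (ys ++ zs))
        (cong₂ _+_ (multiplicity-tabulate c (κ ∘ vx 0F))
                   (trans (multiplicity-++ c ys zs)
                          (cong (_+ multiplicity c zs) (multiplicity-tabulate c (κ ∘ vx 1F)))))

      absentFromZs : ∀ c → occ 2F c ≡ 0 → multiplicity c zs ≡ 0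
      absentFromZs c absent = multiplicity-none {c} {zs} (All.tabulate λ d∈zs d≡c →
        let i , _ , d≡κi = ∈-map⁻ (κ ∘ vx 2F) d∈zs
        in  <⇒≢ (occurring {c} {i} (trans (sym d≡κi) d≡c)) (sym absent))

      atMostOnce : ∀ c → multiplicity c ds ≤ 1
      atMostOnce c = subst (_≤ 1) (sym (multiplicity-ds c))
        (x+[y+w]≤1 {occ 0F c} {occ 1F c} {occ 2F c} {multiplicity c zs}
           (shortPaths≤1 c) (absentFromZs c)
           (shortPaths-vanish c) (Unique⇒multiplicity≤1 zs! c))

      onPath : ∀ s {d} → d ∈ tabulate (κ ∘ vx s) → ∃[ x ] col x ≡ d
      onPath s d∈ = let i , d≡κi = ∈-tabulate⁻ {f = κ ∘ vx s} d∈ in vertexIndex (vx s i) , sym d≡κi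

      onLongPath : ∀ {d} → d ∈ zs → ∃[ x ] col x ≡ d
      onLongPath d∈ = let i , _ , d≡κi = ∈-map⁻ (κ ∘ vx 2F) d∈ in vertexIndex (vx 2F i) , sym d≡κi

      used : ∀ {d} → d ∈ ds → ∃[ x ] col x ≡ d
      used d∈ds = [ onPath 0F , [ onPath 1F , onLongPath ]′ ∘ ∈-++⁻ ys ]′ (∈-++⁻ xs d∈ds)

    atLeastTwelve : 12 ≤ numColours prism col
    atLeastTwelve =
      let i₁ , i₂ , i₃ , i₄ , unique = oddPath-fourColours j (κ ∘ vx 2F) (proper 2F) longPath-odd
      in  shortPaths+long≤numColours (i₁ ∷ i₂ ∷ i₃ ∷ i₄ ∷ []) unique

theorem2 : (k : ℕ) → 3 ≤ k →
    Σ Map (λ G → IsPlane G × Simple G × TwoEdgeConnected G × n G ≡ 4 * k × χfp≡ G 12)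
theorem2 (suc (suc (suc j))) (s≤s (s≤s (s≤s z≤n))) =
  prism , prism-isPlane , prism-simple , prism-twoEdgeConnected , vertexCount≡ j ,
  ( colouring ∘ vertexAt , colouring-fp
  , ≤-antisym (numColours≤ prism _ (colouring<12 ∘ vertexAt)) (atLeastTwelve colouring-fp)) ,
  λ _ → atLeastTwelve
  where
  open Witness j
  vertexCount≡ : ∀ i → 4 + (4 + (4 + i * 2 * 2)) ≡ 4 * (3 + i)
  vertexCount≡ = solve-∀
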